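{- Let $n\ge1$ and $e,k\ge0$. There is a bijection between the set of bi-increasing permutations $\pi\in{\cal S}_n$ with ${\sf exc}(\pi)=e$ and ${\sf dexc}(\pi)=k$ and the set of step polyominoes of width $e+1$, height $n+1$ and area $k+n+1$.
   Context: Permutations $\pi\in{\cal S}_n$ are written as words $\pi_1\cdots\pi_n$. An excedance of $\pi$ is an integer $i\in[n-1]$ with $\pi_i>i$; ${\sf E}(\pi)$ is the set of excedances, ${\sf exc}(\pi)=|{\sf E}(\pi)|$, ${\sf dexc}(\pi)=\sum_{i\in{\sf E}(\pi)}(\pi_i-i)$, and ${\sf inv}(\pi)$ is the number of pairs $i<j$ with $\pi_i>\pi_j$. A permutation is bi-increasing if ${\sf inv}(\pi)={\sf dexc}(\pi)$. A parallelogram polyomino is a finite union of unit cells of the plane bounded by two lattice paths that start at the origin, use only unit steps north $[0,1]$ and east $[1,0]$, end at a common point, and meet only at their start and end points. Its width and height are the coordinates of the common end point, its perimeter is the total boundary length, and its area is its number of cells. A step polyomino is a parallelogram polyomino in which every horizontal boundary segment has length $1$, i.e. neither boundary path contains two consecutive east steps. -}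

module Defs where

open import Data.Nat using (ℕ; zero; suc; _+_; _∸_; _<_; _≤_; _<?_)
open import Data.Nat.Properties using ()
open import Data.Fin using (Fin; toℕ)
open import Data.Vec using (Vec; lookup)
open import Data.Vec.Relation.Unary.Unique.Propositional using (Unique)
open import Data.List using (List; []; _∷_; length; filter; map; allFin; cartesianProduct; take; zipWith)
open import Data.Nat.ListAction using (sum)
open import Data.List.Relation.Unary.Linked using (Linked)
open import Data.Product using (_×_; _,_; proj₁; proj₂)
open import Data.Refinement using (Refinement-syntax)
open import Relation.Binary.PropositionalEquality using (_≡_; _≢_)
open import Relation.Nullary using (¬_)
open import Relation.Nullary.Decidable using (_×-dec_)

-- We use 0-based positions and values: the word is a vector of length n
-- over Fin n (value j : Fin n stands for j+1, position i stands for i+1).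
-- Shifting both by one does not change π_i > i nor π_i - i.

Word : ℕ → Set
Word n = Vec (Fin n) n

IsPermutation : ∀ {n} → Word n → Set
IsPermutation π = Unique π

val : ∀ {n} → Word n → Fin n → ℕ
val π i = toℕ (lookup π i)

excedances : ∀ {n} → Word n → List (Fin n)
excedances {n} π = filter (λ i → toℕ i <? val π i) (allFin n)

exc : ∀ {n} → Word n → ℕ
exc π = length (excedances π)

dexc : ∀ {n} → Word n → ℕ
dexc π = sum (map (λ i → val π i ∸ toℕ i) (excedances π))

inv : ∀ {n} → Word n → ℕ
inv {n} π = length (filter (λ ij → (toℕ (proj₁ ij) <? toℕ (proj₂ ij))
                                     ×-dec (val π (proj₂ ij) <? val π (proj₁ ij)))
                           (cartesianProduct (allFin n) (allFin n)))

BiIncreasing : ∀ {n} → Word n → Set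
BiIncreasing π = inv π ≡ dexc π

BiIncPerms : ℕ → ℕ → ℕ → Set
BiIncPerms n e k =
  [ π ∈ Word n ∣ IsPermutation π × BiIncreasing π × exc π ≡ e × dexc π ≡ k ]

data Step : Set where
  N E : Step

Path : Set
Path = List Step

xEnd : Path → ℕ
xEnd []       = 0
xEnd (N ∷ p)  = xEnd p
xEnd (E ∷ p)  = suc (xEnd p)

yEnd : Path → ℕ
yEnd []       = 0
yEnd (N ∷ p)  = suc (yEnd p)
yEnd (E ∷ p)  = yEnd p

point : Path → ℕ → ℕ × ℕ
point p t = xEnd (take t p) , yEnd (take t p)

eastHeightsFrom : ℕ → Path → List ℕ
eastHeightsFrom y []      = []
eastHeightsFrom y (N ∷ p) = eastHeightsFrom (suc y) p
eastHeightsFrom y (E ∷ p) = y ∷ eastHeightsFrom y p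

eastHeights : Path → List ℕ
eastHeights = eastHeightsFrom 0

-- A parallelogram polyomino is given by its pair of boundary paths
-- (upper , lower): both start at the origin and end at a common point,
-- and they meet only at their start and end points.  To represent each
-- polyomino exactly once we take the upper path first: it starts with a
-- north step and the lower one with an east step.
data FirstStep (s : Step) : Path → Set where
  first : ∀ {q} → FirstStep s (s ∷ q)

IsParallelogramPolyomino : Path × Path → Set
IsParallelogramPolyomino (u , l) =
  xEnd u ≡ xEnd l × yEnd u ≡ yEnd l ×
  FirstStep N u × FirstStep E l ×
  (∀ t → 0 < t → t < length u → point u t ≢ point l t)

width height : Path × Path → ℕ
width  (u , l) = xEnd u
height (u , l) = yEnd u

-- area = number of unit cells enclosed: over column i (0 ≤ i < width) the
-- cells are those [i,i+1]×[j,j+1] with lowerHeight_i ≤ j < upperHeight_i.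
area : Path × Path → ℕ
area (u , l) = sum (zipWith _∸_ (eastHeights u) (eastHeights l))

NoDoubleEast : Path → Set
NoDoubleEast = Linked (λ a b → ¬ (a ≡ E × b ≡ E))

IsStepPolyomino : Path × Path → Set
IsStepPolyomino (u , l) =
  IsParallelogramPolyomino (u , l) × NoDoubleEast u × NoDoubleEast l

StepPolys : ℕ → ℕ → ℕ → Set
StepPolys w h a =
  [ P ∈ Path × Path ∣ IsStepPolyomino P × width P ≡ w × height P ≡ h × area P ≡ a ]

-- For a permutation p of {0, …, n-1}, at most i of the p i values below p i can sit left of
-- position i, so at least p i - i inversions start at i; hence inv ≥ dexc, with equality
-- (bi-increasing) exactly when this holds tightly at every i.  Tightness says that every
-- excedance value exceeds all earlier values and every non-excedance value lies below all later
-- ones, so a bi-increasing p is determined by its excedance positions X and values Y: the other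
-- positions receive the other values in increasing order.  Conversely every pair of increasing
-- lists with X < Y pointwise and Y < n arises, by a Hall-type count.  The pair (X , Y) is then
-- read off a step polyomino of height n + 1: its upper path has east steps at heights Y + 1
-- followed by n + 1, its lower path at heights 0 followed by X + 1.  The two paths meet only at
-- their ends iff X < Y pointwise, no two east steps are adjacent iff X and Y are strictly
-- increasing, and the area telescopes to Σ (Y - X) + n + 1.

module Submission where

open import Defs
open import Data.Nat using (ℕ; suc; _+_; _≤_)
open import Function.Bundles using (_⤖_)

open import Data.Empty using (⊥; ⊥-elim)
open import Data.Fin as Fin using (Fin; toℕ; fromℕ<; zero; suc)
open import Data.Fin.Properties using (toℕ-injective; toℕ<n; toℕ-fromℕ<)
open import Data.Irrelevant using ([_])
open import Data.List using (List; []; _∷_; length; filter; map; zipWith; take; drop; _++_; _∷ʳ_)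
open import Data.List using (allFin; cartesianProduct; upTo; applyUpTo; tabulate)
open import Data.List.Membership.Propositional using (_∈_; _∉_)
open import Data.List.Membership.Propositional.Properties using (∈-filter⁺; ∈-filter⁻; ∈-upTo⁺; ∈-upTo⁻)
open import Data.List.Properties using (length-map; length-++; ∷-injective)
open import Data.List.Properties using (map-∘; map-cong; map-cong-local; map-++; map-tabulate; map-upTo)
import Data.List.Properties as List
open import Data.List.Relation.Binary.Pointwise as Pointwise using (Pointwise; []; _∷_; Pointwise-length)
open import Data.List.Relation.Unary.All as All using (All; []; _∷_)
import Data.List.Relation.Unary.All.Properties as All
open import Data.List.Relation.Unary.Any using (here; there)
open import Data.List.Relation.Unary.Linked using (Linked; []; [-]; _∷_; tail)
open import Data.List.Relation.Unary.Linked.Properties as Linked using (Linked⇒All)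
open import Data.Nat
open import Data.Nat.Induction using (<-rec)
open import Data.Nat.ListAction using (sum)
open import Data.Nat.ListAction.Properties using (sum-++)
open import Data.Nat.Properties
open import Data.List.Membership.DecPropositional _≟_ using (_∈?_)
open import Algebra.Properties.CommutativeSemigroup +-commutativeSemigroup using (interchange; x∙yz≈y∙xz)
open import Data.Product using (_×_; _,_; proj₁; proj₂; Σ-syntax)
open import Data.Product.Properties as Product using (,-injectiveˡ; ,-injectiveʳ)
open import Data.Refinement using (Refinement-syntax; _,_; value-injective)
open import Data.Sum using (_⊎_; inj₁; inj₂)
open import Data.Vec as Vec using (Vec; lookup; []; _∷_)
import Data.Vec.Properties as Vec
open import Data.Vec.Relation.Unary.Unique.Propositional.Properties using (lookup-injective; tabulate⁺)
open import Function using (_∘_; id; _↔_; mk↔ₛ′)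
open import Function.Construct.Composition using (_↔-∘_)
open import Function.Properties.Inverse using (↔⇒⤖)
open import Relation.Binary.Definitions using (DecidableEquality; tri<; tri≈; tri>)
open import Relation.Binary.PropositionalEquality
open import Relation.Nullary using (¬_; Dec; yes; no; _×-dec_; ¬?)
open import Relation.Nullary.Decidable using (recompute)

-- Sums and counts over {0, …, n-1}

sumBelow : ℕ → (ℕ → ℕ) → ℕ
sumBelow zero    f = 0
sumBelow (suc n) f = f 0 + sumBelow n (f ∘ suc)

sumBelow-cong : ∀ n {f g : ℕ → ℕ} → (∀ i → i < n → f i ≡ g i) → sumBelow n f ≡ sumBelow n g
sumBelow-cong zero    eq = refl
sumBelow-cong (suc n) eq = cong₂ _+_ (eq 0 z<s) (sumBelow-cong n (λ i → eq (suc i) ∘ s<s))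

sumBelow-mono-≤ : ∀ n {f g : ℕ → ℕ} → (∀ i → i < n → f i ≤ g i) → sumBelow n f ≤ sumBelow n g
sumBelow-mono-≤ zero    le = z≤n
sumBelow-mono-≤ (suc n) le = +-mono-≤ (le 0 z<s) (sumBelow-mono-≤ n (λ i → le (suc i) ∘ s<s))

sumBelow-+ : ∀ m n f → sumBelow (m + n) f ≡ sumBelow m f + sumBelow n (λ i → f (m + i))
sumBelow-+ zero    n f = refl
sumBelow-+ (suc m) n f = trans (cong (f 0 +_) (sumBelow-+ m n (f ∘ suc))) (sym (+-assoc (f 0) _ _))

sumBelow-suc : ∀ n f → sumBelow (suc n) f ≡ sumBelow n f + f n
sumBelow-suc zero    f = +-comm (f 0) 0
sumBelow-suc (suc n) f = trans (cong (f 0 +_) (sumBelow-suc n (f ∘ suc))) (sym (+-assoc (f 0) _ _))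

sumBelow-distrib-+ : ∀ n f g → sumBelow n (λ i → f i + g i) ≡ sumBelow n f + sumBelow n g
sumBelow-distrib-+ zero    f g = refl
sumBelow-distrib-+ (suc n) f g =
  trans (cong ((f 0 + g 0) +_) (sumBelow-distrib-+ n (f ∘ suc) (g ∘ suc))) (interchange (f 0) (g 0) _ _)

sumBelow-zero : ∀ n → sumBelow n (λ _ → 0) ≡ 0
sumBelow-zero zero    = refl
sumBelow-zero (suc n) = sumBelow-zero n

sumBelow-one : ∀ n → sumBelow n (λ _ → 1) ≡ n
sumBelow-one zero    = refl
sumBelow-one (suc n) = cong suc (sumBelow-one n)

+-mono-≤-≡⇒≡ : ∀ {a b c d} → a ≤ c → b ≤ d → a + b ≡ c + d → a ≡ c × b ≡ d
+-mono-≤-≡⇒≡ {a} {b} {c} {d} a≤c b≤d eq with m≤n⇒m<n∨m≡n a≤c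
... | inj₁ a<c  = ⊥-elim (<⇒≢ (+-mono-<-≤ a<c b≤d) eq)
... | inj₂ refl = refl , +-cancelˡ-≡ a b d eq

sumBelow-mono-≤-≡⇒≡ : ∀ n {f g : ℕ → ℕ} → (∀ i → i < n → f i ≤ g i) →
                      sumBelow n f ≡ sumBelow n g → ∀ i → i < n → f i ≡ g i
sumBelow-mono-≤-≡⇒≡ (suc n) le eq i i<n with +-mono-≤-≡⇒≡ (le 0 z<s) (sumBelow-mono-≤ n (λ j → le (suc j) ∘ s<s)) eq
sumBelow-mono-≤-≡⇒≡ (suc n) le eq zero    _         | head≡ , _ = head≡
sumBelow-mono-≤-≡⇒≡ (suc n) le eq (suc i) (s<s i<n) | _ , tail≡ =
  sumBelow-mono-≤-≡⇒≡ n (λ j → le (suc j) ∘ s<s) tail≡ i i<n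

indicator : ∀ {A : Set} → Dec A → ℕ
indicator (yes _) = 1
indicator (no _)  = 0

module _ {A : Set} where

  indicator-yes : A → (a? : Dec A) → indicator a? ≡ 1
  indicator-yes a (yes _) = refl
  indicator-yes a (no ¬a) = ⊥-elim (¬a a)

  indicator-no : ¬ A → (a? : Dec A) → indicator a? ≡ 0
  indicator-no ¬a (yes a) = ⊥-elim (¬a a)
  indicator-no ¬a (no _)  = refl

  indicator≤1 : (a? : Dec A) → indicator a? ≤ 1
  indicator≤1 (yes _) = ≤-refl
  indicator≤1 (no _)  = z≤n

  indicator≡1⇒ : (a? : Dec A) → indicator a? ≡ 1 → A
  indicator≡1⇒ (yes a) _ = a

  indicator≡0⇒ : (a? : Dec A) → indicator a? ≡ 0 → ¬ A
  indicator≡0⇒ (no ¬a) _ = ¬a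

  indicator-cong : ∀ {B : Set} → (A → B) → (B → A) → (a? : Dec A) (b? : Dec B) → indicator a? ≡ indicator b?
  indicator-cong f g (yes _) (yes _) = refl
  indicator-cong f g (yes a) (no ¬b) = ⊥-elim (¬b (f a))
  indicator-cong f g (no ¬a) (yes b) = ⊥-elim (¬a (g b))
  indicator-cong f g (no _)  (no _)  = refl

count : ∀ {P : ℕ → Set} → ℕ → (∀ i → Dec (P i)) → ℕ
count n P? = sumBelow n (λ i → indicator (P? i))

module _ {P : ℕ → Set} (P? : ∀ i → Dec (P i)) where

  count≤ : ∀ n → count n P? ≤ n
  count≤ n = subst (count n P? ≤_) (sumBelow-one n) (sumBelow-mono-≤ n (λ i _ → indicator≤1 (P? i)))

  count-suc : ∀ n → count (suc n) P? ≡ count n P? + indicator (P? n)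
  count-suc n = sumBelow-suc n (λ i → indicator (P? i))

  count-mono-≤ : ∀ {m n} → m ≤ n → count m P? ≤ count n P?
  count-mono-≤ {m} {n} m≤n = subst (λ k → count m P? ≤ count k P?) (m+[n∸m]≡n m≤n)
    (subst (count m P? ≤_) (sym (sumBelow-+ m (n ∸ m) _)) (m≤m+n _ _))

  count-mono-< : ∀ {j i} → P j → j < i → count j P? < count i P?
  count-mono-< {j} pj j<i = <-≤-trans count<count-suc (count-mono-≤ j<i)
    where
    count<count-suc : count j P? < count (suc j) P?
    count<count-suc = subst (count j P? <_)
      (sym (trans (count-suc j) (cong (count j P? +_) (indicator-yes pj (P? j))))) (m<m+n _ z<s)

  count-all : ∀ n → (∀ i → i < n → P i) → count n P? ≡ n
  count-all n all = trans (sumBelow-cong n (λ i i<n → indicator-yes (all i i<n) (P? i))) (sumBelow-one n)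

  count-none : ∀ n → (∀ i → i < n → ¬ P i) → count n P? ≡ 0
  count-none n none = trans (sumBelow-cong n (λ i i<n → indicator-no (none i i<n) (P? i))) (sumBelow-zero n)

  count≡n⇒all : ∀ n → count n P? ≡ n → ∀ i → i < n → P i
  count≡n⇒all n eq i i<n = indicator≡1⇒ (P? i)
    (sumBelow-mono-≤-≡⇒≡ n (λ j _ → indicator≤1 (P? j)) (trans eq (sym (sumBelow-one n))) i i<n)

  count≡0⇒none : ∀ n → count n P? ≡ 0 → ∀ i → i < n → ¬ P i
  count≡0⇒none n eq i i<n = indicator≡0⇒ (P? i)
    (sym (sumBelow-mono-≤-≡⇒≡ n (λ _ _ → z≤n) (trans (sumBelow-zero n) (sym eq)) i i<n))

  count-complement : ∀ n → count n P? + count n (λ i → ¬? (P? i)) ≡ n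
  count-complement n = trans (sym (sumBelow-distrib-+ n _ _)) (trans (sumBelow-cong n (λ i _ → split (P? i))) (sumBelow-one n))
    where
    split : ∀ {A : Set} (a? : Dec A) → indicator a? + indicator (¬? a?) ≡ 1
    split (yes _) = refl
    split (no _)  = refl

count-witness : ∀ {P : ℕ → Set} (P? : ∀ i → Dec (P i)) n → 0 < count n P? → Σ[ i ∈ ℕ ] i < n × P i
count-witness P? (suc n) pos with P? 0
... | yes p0 = 0 , z<s , p0
... | no _ with count-witness (P? ∘ suc) n pos
...   | i , i<n , pi = suc i , s<s i<n , pi

count-cong : ∀ {P Q : ℕ → Set} (P? : ∀ i → Dec (P i)) (Q? : ∀ i → Dec (Q i)) n →
             (∀ i → i < n → P i → Q i) → (∀ i → i < n → Q i → P i) → count n P? ≡ count n Q?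
count-cong P? Q? n f g = sumBelow-cong n (λ i i<n → indicator-cong (f i i<n) (g i i<n) (P? i) (Q? i))

count-below : ∀ {n v} → v ≤ n → count n (λ i → i <? v) ≡ v
count-below {n} {v} v≤n = begin
  count n (λ i → i <? v)
    ≡⟨ cong (λ m → count m (λ i → i <? v)) (sym (m+[n∸m]≡n v≤n)) ⟩
  sumBelow (v + (n ∸ v)) (λ i → indicator (i <? v))
    ≡⟨ sumBelow-+ v (n ∸ v) _ ⟩
  count v (λ i → i <? v) + count (n ∸ v) (λ i → v + i <? v)
    ≡⟨ cong₂ _+_ (count-all (λ i → i <? v) v (λ _ i<v → i<v))
      (count-none (λ i → v + i <? v) (n ∸ v) (λ i _ → m+n≮m v i)) ⟩
  v + 0
    ≡⟨ +-identityʳ v ⟩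
  v ∎
  where open ≡-Reasoning

count-single : ∀ {n c} → c < n → count n (λ i → i ≟ c) ≡ 1
count-single {n} {c} c<n = begin
  count n (λ i → i ≟ c)
    ≡⟨ cong (λ m → count m (λ i → i ≟ c)) (sym (m+[n∸m]≡n (<⇒≤ c<n))) ⟩
  sumBelow (c + (n ∸ c)) (λ i → indicator (i ≟ c))
    ≡⟨ sumBelow-+ c (n ∸ c) _ ⟩
  count c (λ i → i ≟ c) + count (n ∸ c) (λ i → c + i ≟ c)
    ≡⟨ cong₂ _+_ (count-none (λ i → i ≟ c) c (λ _ i<c → <⇒≢ i<c))
      (only-first (n ∸ c) (m>n⇒m∸n≢0 c<n)) ⟩
  1 ∎
  where
  open ≡-Reasoning
  only-first : ∀ m → m ≢ 0 → count m (λ i → c + i ≟ c) ≡ 1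
  only-first zero    m≢0 = ⊥-elim (m≢0 refl)
  only-first (suc m) _   = cong₂ _+_ (indicator-yes (+-identityʳ c) (c + 0 ≟ c))
                                     (count-none (λ i → c + suc i ≟ c) m (λ i _ → m+1+n≢m c))

module _ {Q : ℕ → Set} (Q? : ∀ w → Dec (Q w)) where

  count-remove : ∀ {m c} → c < m → Q c → count m Q? ≡ suc (count m (λ w → Q? w ×-dec ¬? (w ≟ c)))
  count-remove {m} {c} c<m qc = begin
    count m Q?
      ≡⟨ sumBelow-cong m (λ w _ → split w) ⟩
    sumBelow m (λ w → indicator (Q? w ×-dec ¬? (w ≟ c)) + indicator (w ≟ c))
      ≡⟨ sumBelow-distrib-+ m _ _ ⟩
    count m (λ w → Q? w ×-dec ¬? (w ≟ c)) + count m (λ w → w ≟ c)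
      ≡⟨ cong (count m (λ w → Q? w ×-dec ¬? (w ≟ c)) +_) (count-single c<m) ⟩
    count m (λ w → Q? w ×-dec ¬? (w ≟ c)) + 1
      ≡⟨ +-comm _ 1 ⟩
    suc (count m (λ w → Q? w ×-dec ¬? (w ≟ c))) ∎
    where
    open ≡-Reasoning
    split : ∀ w → indicator (Q? w) ≡ indicator (Q? w ×-dec ¬? (w ≟ c)) + indicator (w ≟ c)
    split w with w ≟ c
    ... | yes refl = trans (indicator-yes qc (Q? w)) (cong (_+ 1) (sym (indicator-no (λ (_ , w≢w) → w≢w refl) _)))
    ... | no _ with Q? w
    ...   | yes _ = refl
    ...   | no _  = refl

count-∘-injective-≤ : ∀ {n m} {p : ℕ → ℕ} → (∀ i → i < n → p i < m) →
                      (∀ i j → i < n → j < n → p i ≡ p j → i ≡ j) →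
                      ∀ {Q : ℕ → Set} (Q? : ∀ w → Dec (Q w)) → count n (λ i → Q? (p i)) ≤ count m Q?
count-∘-injective-≤ {zero}          bound inj Q? = z≤n
count-∘-injective-≤ {suc n} {m} {p} bound inj {Q} Q? =
  subst (_≤ count m Q?) (sym (count-suc (λ i → Q? (p i)) n)) (step (Q? (p n)))
  where
  bound′ : ∀ i → i < n → p i < m
  bound′ i i<n = bound i (m<n⇒m<1+n i<n)
  inj′ : ∀ i j → i < n → j < n → p i ≡ p j → i ≡ j
  inj′ i j i<n j<n = inj i j (m<n⇒m<1+n i<n) (m<n⇒m<1+n j<n)
  step : (q? : Dec (Q (p n))) → count n (λ i → Q? (p i)) + indicator q? ≤ count m Q?
  step (no _)  = subst (_≤ count m Q?) (sym (+-identityʳ _)) (count-∘-injective-≤ bound′ inj′ Q?)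
  step (yes q) = begin
    count n (λ i → Q? (p i)) + 1
      ≡⟨ cong (_+ 1) (count-cong _ _ n (λ i i<n qi → qi , p≢pn i i<n) (λ _ _ → proj₁)) ⟩
    count n (λ i → Q′? (p i)) + 1
      ≤⟨ +-monoˡ-≤ 1 (count-∘-injective-≤ bound′ inj′ Q′?) ⟩
    count m Q′? + 1
      ≡⟨ +-comm _ 1 ⟩
    suc (count m Q′?)
      ≡⟨ count-remove Q? (bound n ≤-refl) q ⟨
    count m Q? ∎
    where
    open ≤-Reasoning
    Q′? : ∀ w → Dec (Q w × ¬ w ≡ p n)
    Q′? w = Q? w ×-dec ¬? (w ≟ p n)
    p≢pn : ∀ i → i < n → ¬ p i ≡ p n
    p≢pn i i<n eq = <⇒≢ i<n (inj i n (m<n⇒m<1+n i<n) ≤-refl eq)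

module _ {Q : ℕ → Set} (Q? : ∀ w → Dec (Q w)) where

  select : ℕ → ℕ → ℕ
  select zero    r = 0
  select (suc M) r with r <? count M Q?
  ... | yes _ = select M r
  ... | no _  = M

  select-spec : ∀ M r → r < count M Q? → Q (select M r) × count (select M r) Q? ≡ r × select M r < M
  select-spec (suc M) r r<c with r <? count M Q?
  ... | yes r<cM = let q , c≡r , s<M = select-spec M r r<cM in q , c≡r , m<n⇒m<1+n s<M
  ... | no r≮cM  = last (Q? M) (subst (r <_) (count-suc Q? M) r<c)
    where
    last : (q? : Dec (Q M)) → r < count M Q? + indicator q? → Q M × count M Q? ≡ r × M < suc M
    last (yes q) r<c+1 = q , ≤-antisym (≮⇒≥ r≮cM) (s≤s⁻¹ (subst (r <_) (+-comm _ 1) r<c+1)) , n<1+n M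
    last (no _)  r<c+0 = ⊥-elim (r≮cM (subst (r <_) (+-identityʳ _) r<c+0))

  select-mono-< : ∀ M {r r′} → r < r′ → r′ < count M Q? → select M r < select M r′
  select-mono-< M {r} {r′} r<r′ r′<c with select-spec M r (<-trans r<r′ r′<c) | select-spec M r′ r′<c
  ... | _ , c≡r , _ | _ , c≡r′ , _ =
    ≰⇒> (λ s′≤s → <⇒≱ r<r′ (subst₂ _≤_ c≡r′ c≡r (count-mono-≤ Q? s′≤s)))

  select-≤ : ∀ M {r q} → r < count M Q? → r < count (suc q) Q? → select M r ≤ q
  select-≤ M {r} {q} r<c r<cq with select-spec M r r<c
  ... | _ , c≡r , _ = ≮⇒≥ (λ q<s → <⇒≱ r<cq (subst (count (suc q) Q? ≤_) c≡r (count-mono-≤ Q? q<s)))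

-- Permutations of {0, …, n-1} as functions on ℕ

record IsPermutationBelow (n : ℕ) (p : ℕ → ℕ) : Set where
  field
    bounded   : ∀ i → i < n → p i < n
    injective : ∀ i j → i < n → j < n → p i ≡ p j → i ≡ j

inversionsAt : (ℕ → ℕ) → ℕ → ℕ → ℕ
inversionsAt p n i = count n (λ j → (i <? j) ×-dec (p j <? p i))

inversions : (ℕ → ℕ) → ℕ → ℕ
inversions p n = sumBelow n (inversionsAt p n)

-- dexc: thanks to truncated subtraction the non-excedances contribute 0
excedanceDistance : (ℕ → ℕ) → ℕ → ℕ
excedanceDistance p n = sumBelow n (λ i → p i ∸ i)

BiIncreasingBelow : ℕ → (ℕ → ℕ) → Set
BiIncreasingBelow n p = IsPermutationBelow n p × inversions p n ≡ excedanceDistance p n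

module _ {n : ℕ} {p q : ℕ → ℕ} (p≗q : ∀ i → i < n → p i ≡ q i) where

  inversions-cong : inversions p n ≡ inversions q n
  inversions-cong = sumBelow-cong n λ i i<n → count-cong _ _ n
    (λ j j<n (i<j , pj<pi) → i<j , subst₂ _<_ (p≗q j j<n) (p≗q i i<n) pj<pi)
    (λ j j<n (i<j , qj<qi) → i<j , subst₂ _<_ (sym (p≗q j j<n)) (sym (p≗q i i<n)) qj<qi)

  excedanceDistance-cong : excedanceDistance p n ≡ excedanceDistance q n
  excedanceDistance-cong = sumBelow-cong n (λ i i<n → cong (_∸ i) (p≗q i i<n))

module _ {n : ℕ} {p : ℕ → ℕ} (π : IsPermutationBelow n p) where
  open IsPermutationBelow π

  count-values-below : ∀ {v} → v ≤ n → count n (λ j → p j <? v) ≡ v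
  count-values-below {v} v≤n = ≤-antisym at-most at-least
    where
    at-most : count n (λ j → p j <? v) ≤ v
    at-most = subst (count n (λ j → p j <? v) ≤_) (count-below v≤n) (count-∘-injective-≤ bounded injective (_<? v))
    at-least : v ≤ count n (λ j → p j <? v)
    at-least = +-cancelʳ-≤ (count n (λ w → ¬? (w <? v))) v _ (begin
      v + count n (λ w → ¬? (w <? v))
        ≡⟨ cong (_+ count n (λ w → ¬? (w <? v))) (count-below v≤n) ⟨
      count n (λ w → w <? v) + count n (λ w → ¬? (w <? v))
        ≡⟨ count-complement (_<? v) n ⟩
      n
        ≡⟨ count-complement (λ j → p j <? v) n ⟨
      count n (λ j → p j <? v) + count n (λ j → ¬? (p j <? v))
        ≤⟨ +-monoʳ-≤ (count n (λ j → p j <? v)) (count-∘-injective-≤ bounded injective (λ w → ¬? (w <? v))) ⟩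
      count n (λ j → p j <? v) + count n (λ w → ¬? (w <? v)) ∎)
      where open ≤-Reasoning

  surjective : ∀ v → v < n → Σ[ j ∈ ℕ ] j < n × p j ≡ v
  surjective v v<n with 0 <? count n (λ j → p j ≟ v)
  ... | yes hit = count-witness (λ j → p j ≟ v) n hit
  ... | no miss = ⊥-elim (1+n≢n (sym (begin
    v                            ≡⟨ count-values-below (<⇒≤ v<n) ⟨
    count n (λ j → p j <? v)     ≡⟨ count-cong _ _ n (λ _ _ → m<n⇒m<1+n) below-suc ⟩
    count n (λ j → p j <? suc v) ≡⟨ count-values-below v<n ⟩
    suc v                        ∎)))
    where
    open ≡-Reasoning
    below-suc : ∀ j → j < n → p j < suc v → p j < v
    below-suc j j<n pj≤v =
      ≤∧≢⇒< (s≤s⁻¹ pj≤v) (count≡0⇒none (λ j → p j ≟ v) n (n≤0⇒n≡0 (≮⇒≥ miss)) j j<n)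

  smallerBefore+inversionsAt : ∀ i → i < n → count i (λ j → p j <? p i) + inversionsAt p n i ≡ p i
  smallerBefore+inversionsAt i i<n = begin
    count i (λ j → p j <? p i) + inversionsAt p n i
      ≡⟨ cong₂ _+_ (sym smallerUpTo-i) inversions-split ⟩
    count (suc i) (λ j → p j <? p i) + count r (λ j → p (suc i + j) <? p i)
      ≡⟨ sumBelow-+ (suc i) r (λ j → indicator (p j <? p i)) ⟨
    count (suc i + r) (λ j → p j <? p i)
      ≡⟨ cong (λ m → count m (λ j → p j <? p i)) (m+[n∸m]≡n i<n) ⟩
    count n (λ j → p j <? p i)
      ≡⟨ count-values-below (<⇒≤ (bounded i i<n)) ⟩
    p i ∎
    where
    open ≡-Reasoning
    r = n ∸ suc i
    smallerUpTo-i : count (suc i) (λ j → p j <? p i) ≡ count i (λ j → p j <? p i)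
    smallerUpTo-i = trans (count-suc (λ j → p j <? p i) i)
                          (trans (cong (count i (λ j → p j <? p i) +_) (indicator-no (n≮n (p i)) (p i <? p i))) (+-identityʳ _))
    inversions-split : inversionsAt p n i ≡ count r (λ j → p (suc i + j) <? p i)
    inversions-split = begin
      inversionsAt p n i
        ≡⟨ cong (λ m → count m (λ j → (i <? j) ×-dec (p j <? p i))) (m+[n∸m]≡n i<n) ⟨
      count (suc i + r) (λ j → (i <? j) ×-dec (p j <? p i))
        ≡⟨ sumBelow-+ (suc i) r (λ j → indicator ((i <? j) ×-dec (p j <? p i))) ⟩
      count (suc i) (λ j → (i <? j) ×-dec (p j <? p i)) + count r (λ j → (i <? suc i + j) ×-dec (p (suc i + j) <? p i))
        ≡⟨ cong₂ _+_ (count-none (λ j → (i <? j) ×-dec (p j <? p i)) (suc i)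
                                 (λ j j≤i (i<j , _) → <⇒≱ i<j (s≤s⁻¹ j≤i)))
                     (count-cong _ _ r (λ _ _ → proj₂) (λ j _ q → s≤s (m≤m+n i j) , q)) ⟩
      count r (λ j → p (suc i + j) <? p i)
        ∎

  p∸i≤inversionsAt : ∀ i → i < n → p i ∸ i ≤ inversionsAt p n i
  p∸i≤inversionsAt i i<n = begin
    p i ∸ i                                            ≤⟨ ∸-monoʳ-≤ (p i) (count≤ (λ j → p j <? p i) i) ⟩
    p i ∸ smallerBefore                                ≡⟨ cong (_∸ smallerBefore) (smallerBefore+inversionsAt i i<n) ⟨
    smallerBefore + inversionsAt p n i ∸ smallerBefore ≡⟨ m+n∸m≡n smallerBefore (inversionsAt p n i) ⟩
    inversionsAt p n i                                 ∎
    where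
    open ≤-Reasoning
    smallerBefore = count i (λ j → p j <? p i)

  module _ (bi : inversions p n ≡ excedanceDistance p n) where

    inversionsAt≡p∸i : ∀ i → i < n → inversionsAt p n i ≡ p i ∸ i
    inversionsAt≡p∸i i i<n = sym (sumBelow-mono-≤-≡⇒≡ n p∸i≤inversionsAt (sym bi) i i<n)

    nonexcedance⇒suffix-minimum : ∀ {i j} → i < n → p i ≤ i → i < j → j < n → p i ≤ p j
    nonexcedance⇒suffix-minimum {i} {j} i<n pi≤i i<j j<n = ≮⇒≥ λ pj<pi →
      count≡0⇒none (λ j → (i <? j) ×-dec (p j <? p i)) n no-inversions j j<n (i<j , pj<pi)
      where
      no-inversions : inversionsAt p n i ≡ 0
      no-inversions = trans (inversionsAt≡p∸i i i<n) (m≤n⇒m∸n≡0 pi≤i)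

    excedance⇒prefix-maximum : ∀ {i j} → i < n → i < p i → j < i → p j < p i
    excedance⇒prefix-maximum {i} {j} i<n i<pi j<i = count≡n⇒all (λ j → p j <? p i) i all-smaller j j<i
      where
      all-smaller : count i (λ j → p j <? p i) ≡ i
      all-smaller = +-cancelʳ-≡ (p i ∸ i) _ _ (begin
        count i (λ j → p j <? p i) + (p i ∸ i)          ≡⟨ cong (count i (λ j → p j <? p i) +_) (inversionsAt≡p∸i i i<n) ⟨
        count i (λ j → p j <? p i) + inversionsAt p n i ≡⟨ smallerBefore+inversionsAt i i<n ⟩
        p i                                             ≡⟨ m+[n∸m]≡n (<⇒≤ i<pi) ⟨
        i + (p i ∸ i)                                   ∎)
        where open ≡-Reasoning

-- s takes the value p i at some position j, and each of j < i, j = i, j > i contradicts p i < s i.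
nonexcedance-≥ : ∀ {n p s} → BiIncreasingBelow n p → BiIncreasingBelow n s →
                 ∀ {i} → i < n → s i ≤ i → (∀ j → j < i → p j ≡ s j) → s i ≤ p i
nonexcedance-≥ {n} {p} {s} (π , _) (σ , biσ) {i} i<n si≤i agree =
  ≮⇒≥ λ pi<si → refute pi<si (surjective σ (p i) (bounded π i i<n))
  where
  open IsPermutationBelow
  refute : p i < s i → Σ[ j ∈ ℕ ] j < n × s j ≡ p i → ⊥
  refute pi<si (j , j<n , sj≡pi) with <-cmp j i
  ... | tri< j<i _ _  = <⇒≢ j<i (injective π j i j<n i<n (trans (agree j j<i) sj≡pi))
  ... | tri≈ _ refl _ = <⇒≢ pi<si (sym sj≡pi)
  ... | tri> _ _ i<j  = <⇒≱ pi<si (subst (s i ≤_) sj≡pi (nonexcedance⇒suffix-minimum σ biσ i<n si≤i i<j j<n))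

biIncreasing-unique : ∀ {n p s} → BiIncreasingBelow n p → BiIncreasingBelow n s →
                      (∀ i → i < n → i < p i → p i ≡ s i) → (∀ i → i < n → i < s i → p i ≡ s i) →
                      ∀ i → i < n → p i ≡ s i
biIncreasing-unique {n} {p} {s} bp bs at-p at-s = <-rec (λ i → i < n → p i ≡ s i) step
  where
  step : ∀ i → (∀ {j} → j < i → j < n → p j ≡ s j) → i < n → p i ≡ s i
  step i ih i<n with i <? p i | i <? s i
  ... | yes i<pi | _        = at-p i i<n i<pi
  ... | no _     | yes i<si = at-s i i<n i<si
  ... | no i≮pi  | no i≮si  = ≤-antisym
    (nonexcedance-≥ bs bp i<n (≮⇒≥ i≮pi) (λ j j<i → sym (ih j<i (<-trans j<i i<n))))
    (nonexcedance-≥ bp bs i<n (≮⇒≥ i≮si) (λ j j<i → ih j<i (<-trans j<i i<n)))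

-- Rebuilding a bi-increasing permutation from its excedances

head<tail : ∀ {y ys} → Linked _<_ (y ∷ ys) → All (y <_) ys
head<tail [-]         = []
head<tail (y<z ∷ lnk) = Linked⇒All <-trans y<z lnk

head∉tail : ∀ {y ys} → Linked _<_ (y ∷ ys) → y ∉ ys
head∉tail lnk y∈ys = n≮n _ (All.lookup (head<tail lnk) y∈ys)

-- 0 past the end of the list
nth : List ℕ → ℕ → ℕ
nth []       r       = 0
nth (y ∷ ys) zero    = y
nth (y ∷ ys) (suc r) = nth ys r

nth-∈ : ∀ ys {r} → r < length ys → nth ys r ∈ ys
nth-∈ (y ∷ ys) {zero}  _         = here refl
nth-∈ (y ∷ ys) {suc r} (s<s r<l) = there (nth-∈ ys r<l)

nth-mono-< : ∀ {ys r r′} → Linked _<_ ys → r < r′ → r′ < length ys → nth ys r < nth ys r′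
nth-mono-< {y ∷ ys} {zero}  {suc r′} lnk _         (s<s r′<l) = All.lookup (head<tail lnk) (nth-∈ ys r′<l)
nth-mono-< {y ∷ ys} {suc r} {suc r′} lnk (s<s r<r′) (s<s r′<l) = nth-mono-< (tail lnk) r<r′ r′<l

nth-pointwise : ∀ {R : ℕ → ℕ → Set} {xs ys r} → Pointwise R xs ys → r < length xs → R (nth xs r) (nth ys r)
nth-pointwise {r = zero}  (x∼y ∷ _)  _         = x∼y
nth-pointwise {r = suc r} (_ ∷ xs∼ys) (s<s r<l) = nth-pointwise xs∼ys r<l

count-∈-∷ : ∀ {x xs} b → x ∉ xs → count b (λ j → j ∈? (x ∷ xs)) ≡ indicator (x <? b) + count b (λ j → j ∈? xs)
count-∈-∷ {x} {xs} b x∉xs = begin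
  count b (λ j → j ∈? (x ∷ xs))                              ≡⟨ sumBelow-cong b (λ j _ → split j (j ≟ x) (j ∈? xs)) ⟩
  sumBelow b (λ j → indicator (j ≟ x) + indicator (j ∈? xs)) ≡⟨ sumBelow-distrib-+ b _ _ ⟩
  count b (λ j → j ≟ x) + count b (λ j → j ∈? xs)            ≡⟨ cong (_+ count b (λ j → j ∈? xs)) (count-≟ (x <? b)) ⟩
  indicator (x <? b) + count b (λ j → j ∈? xs)               ∎
  where
  open ≡-Reasoning
  split : ∀ j → (j≟x : Dec (j ≡ x)) (j∈?xs : Dec (j ∈ xs)) →
          indicator (j ∈? (x ∷ xs)) ≡ indicator j≟x + indicator j∈?xs
  split j (yes refl) (yes j∈xs) = ⊥-elim (x∉xs j∈xs)
  split j (yes refl) (no _)     = indicator-yes (here refl) (j ∈? (x ∷ xs))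
  split j (no _)     (yes j∈xs) = indicator-yes (there j∈xs) (j ∈? (x ∷ xs))
  split j (no j≢x)   (no j∉xs)  =
    indicator-no (λ { (here j≡x) → j≢x j≡x ; (there j∈xs) → j∉xs j∈xs }) (j ∈? (x ∷ xs))
  count-≟ : (x<?b : Dec (x < b)) → count b (λ j → j ≟ x) ≡ indicator x<?b
  count-≟ (yes x<b) = count-single x<b
  count-≟ (no x≮b)  = count-none (λ j → j ≟ x) b (λ j j<b j≡x → x≮b (subst (_< b) j≡x j<b))

rank : List ℕ → ℕ → ℕ
rank xs x = count x (λ j → j ∈? xs)

rank-head : ∀ {x xs} → Linked _<_ (x ∷ xs) → rank (x ∷ xs) x ≡ 0
rank-head lnk = count-none _ _ λ j j<x j∈ → n≮n _ (All.lookup (Linked⇒All <-trans j<x lnk) j∈)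

rank-tail : ∀ {x₀ xs x} → Linked _<_ (x₀ ∷ xs) → x₀ < x → rank (x₀ ∷ xs) x ≡ suc (rank xs x)
rank-tail {x₀} {xs} {x} lnk x₀<x =
  trans (count-∈-∷ x (head∉tail lnk)) (cong (_+ rank xs x) (indicator-yes x₀<x (x₀ <? x)))

nth-rank : ∀ {xs x} → Linked _<_ xs → x ∈ xs → nth xs (rank xs x) ≡ x × rank xs x < length xs
nth-rank {x₀ ∷ xs} lnk (here refl) rewrite rank-head lnk = refl , z<s
nth-rank {x₀ ∷ xs} lnk (there x∈xs) rewrite rank-tail lnk (All.lookup (head<tail lnk) x∈xs) =
  let nth≡ , r<l = nth-rank (tail lnk) x∈xs in nth≡ , s<s r<l

map-nth-rank : ∀ {xs ys} → Linked _<_ xs → length xs ≡ length ys → map (λ x → nth ys (rank xs x)) xs ≡ ys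
map-nth-rank {[]}     {[]}     _   _   = refl
map-nth-rank {x₀ ∷ xs} {y ∷ ys} lnk len = cong₂ _∷_
  (cong (nth (y ∷ ys)) (rank-head lnk))
  (trans (map-cong-local (All.map (λ x₀<x → cong (nth (y ∷ ys)) (rank-tail lnk x₀<x)) (head<tail lnk)))
         (map-nth-rank (tail lnk) (suc-injective len)))

count-∈-pointwise-< : ∀ {xs ys} → Linked _<_ xs → Linked _<_ ys → Pointwise _<_ xs ys →
                      ∀ i → count (suc i) (λ j → j ∈? ys) ≤ count i (λ j → j ∈? xs)
count-∈-pointwise-< _ _ [] i =
  ≤-reflexive (trans (count-none (_∈? []) (suc i) (λ _ _ ())) (sym (count-none (_∈? []) i (λ _ _ ()))))
count-∈-pointwise-< {x ∷ xs} {y ∷ ys} lx ly (x<y ∷ xs<ys) i = begin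
  count (suc i) (λ j → j ∈? (y ∷ ys))
    ≡⟨ count-∈-∷ (suc i) (head∉tail ly) ⟩
  indicator (y <? suc i) + count (suc i) (λ j → j ∈? ys)
    ≤⟨ +-mono-≤ (head-≤ (y <? suc i) (x <? i)) (count-∈-pointwise-< (tail lx) (tail ly) xs<ys i) ⟩
  indicator (x <? i) + count i (λ j → j ∈? xs)
    ≡⟨ count-∈-∷ i (head∉tail lx) ⟨
  count i (λ j → j ∈? (x ∷ xs)) ∎
  where
  open ≤-Reasoning
  head-≤ : (y<?i+1 : Dec (y < suc i)) (x<?i : Dec (x < i)) → indicator y<?i+1 ≤ indicator x<?i
  head-≤ (yes y≤i) (no x≮i) = ⊥-elim (x≮i (<-≤-trans x<y (s≤s⁻¹ y≤i)))
  head-≤ (yes _)   (yes _)  = ≤-refl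
  head-≤ (no _)    _        = z≤n

record IsExcedanceData (n : ℕ) (X Y : List ℕ) : Set where
  field
    X-increasing : Linked _<_ X
    Y-increasing : Linked _<_ Y
    X<Y          : Pointwise _<_ X Y
    Y<n          : All (_< n) Y

-- Excedance positions i ∈ X are sent to the entries of Y in order; the remaining
-- positions receive the values missing from Y, in increasing order.
fromExcedanceData : ℕ → List ℕ → List ℕ → ℕ → ℕ
fromExcedanceData n X Y i with i ∈? X
... | yes _ = nth Y (rank X i)
... | no _  = select (λ w → ¬? (w ∈? Y)) n (count i (λ j → ¬? (j ∈? X)))

module _ {n X Y} (D : IsExcedanceData n X Y) where
  open IsExcedanceData D

  private
    p : ℕ → ℕ
    p = fromExcedanceData n X Y
    ∉X? : ∀ j → Dec (j ∉ X)
    ∉X? j = ¬? (j ∈? X)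
    ∉Y? : ∀ w → Dec (w ∉ Y)
    ∉Y? w = ¬? (w ∈? Y)

  -- Hall-type count: enough values missing from Y remain for the positions missing from X
  count∉X<count∉Y : ∀ i → count i ∉X? < count (suc i) ∉Y?
  count∉X<count∉Y i = +-cancelˡ-≤ (count i (_∈? X)) _ _ (begin
    count i (_∈? X) + suc (count i ∉X?)
      ≡⟨ +-suc _ _ ⟩
    suc (count i (_∈? X) + count i ∉X?)
      ≡⟨ cong suc (count-complement (_∈? X) i) ⟩
    suc i
      ≡⟨ count-complement (_∈? Y) (suc i) ⟨
    count (suc i) (_∈? Y) + count (suc i) ∉Y?
      ≤⟨ +-monoˡ-≤ _ (count-∈-pointwise-< X-increasing Y-increasing X<Y i) ⟩
    count i (_∈? X) + count (suc i) ∉Y? ∎)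
    where open ≤-Reasoning

  private
    selectable : ∀ {i} → i < n → count i ∉X? < count n ∉Y?
    selectable {i} i<n = <-≤-trans (count∉X<count∉Y i) (count-mono-≤ ∉Y? i<n)

  fromExcedanceData-∈ : ∀ {i} → i ∈ X → p i ≡ nth Y (rank X i)
  fromExcedanceData-∈ {i} i∈X with i ∈? X
  ... | yes _   = refl
  ... | no i∉X  = ⊥-elim (i∉X i∈X)

  fromExcedanceData-∉ : ∀ {i} → i ∉ X → p i ≡ select ∉Y? n (count i ∉X?)
  fromExcedanceData-∉ {i} i∉X with i ∈? X
  ... | yes i∈X = ⊥-elim (i∉X i∈X)
  ... | no _    = refl

  rank<length : ∀ {i} → i ∈ X → rank X i < length Y
  rank<length {i} i∈X = subst (rank X i <_) (Pointwise-length X<Y) (proj₂ (nth-rank X-increasing i∈X))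

  module _ {i} (i∈X : i ∈ X) where

    ∈X⇒value∈Y : p i ∈ Y
    ∈X⇒value∈Y = subst (_∈ Y) (sym (fromExcedanceData-∈ i∈X)) (nth-∈ Y (rank<length i∈X))

    ∈X⇒excedance : i < p i
    ∈X⇒excedance = subst₂ _<_ (proj₁ (nth-rank X-increasing i∈X)) (sym (fromExcedanceData-∈ i∈X))
                          (nth-pointwise X<Y (proj₂ (nth-rank X-increasing i∈X)))

    ∈X⇒bounded : p i < n
    ∈X⇒bounded = All.lookup Y<n ∈X⇒value∈Y


  module _ {i} (i∉X : i ∉ X) (i<n : i < n) where
    private
      spec = select-spec ∉Y? n (count i ∉X?) (selectable i<n)

    ∉X⇒value∉Y : p i ∉ Y
    ∉X⇒value∉Y = subst (_∉ Y) (sym (fromExcedanceData-∉ i∉X)) (proj₁ spec)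

    ∉X⇒bounded : p i < n
    ∉X⇒bounded = subst (_< n) (sym (fromExcedanceData-∉ i∉X)) (proj₂ (proj₂ spec))

    ∉X⇒nonexcedance : p i ≤ i
    ∉X⇒nonexcedance = subst (_≤ i) (sym (fromExcedanceData-∉ i∉X)) (select-≤ ∉Y? n (selectable i<n) (count∉X<count∉Y i))

  -- Case splits go through helpers on Dec (j ∈ X): a with on j ∈? X would also abstract
  -- the copy of that test inside p j.
  ∈X⇒prefix-maximum : ∀ {i j} → i ∈ X → j < i → p j < p i
  ∈X⇒prefix-maximum {i} {j} i∈X j<i = by-cases (j ∈? X)
    where
    by-cases : Dec (j ∈ X) → p j < p i
    by-cases (yes j∈X) = subst₂ _<_ (sym (fromExcedanceData-∈ j∈X)) (sym (fromExcedanceData-∈ i∈X))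
                           (nth-mono-< Y-increasing (count-mono-< (_∈? X) j∈X j<i) (rank<length i∈X))
    by-cases (no j∉X)  = ≤-<-trans (∉X⇒nonexcedance j∉X (<-trans j<i (<-trans (∈X⇒excedance i∈X) (∈X⇒bounded i∈X))))
                                   (<-trans j<i (∈X⇒excedance i∈X))

  ∉X⇒suffix-minimum : ∀ {i j} → i ∉ X → i < j → j < n → p i < p j
  ∉X⇒suffix-minimum {i} {j} i∉X i<j j<n = by-cases (j ∈? X)
    where
    by-cases : Dec (j ∈ X) → p i < p j
    by-cases (yes j∈X) = ≤-<-trans (∉X⇒nonexcedance i∉X (<-trans i<j j<n)) (<-trans i<j (∈X⇒excedance j∈X))
    by-cases (no j∉X)  = subst₂ _<_ (sym (fromExcedanceData-∉ i∉X)) (sym (fromExcedanceData-∉ j∉X))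
                           (select-mono-< ∉Y? n (count-mono-< ∉X? i∉X i<j) (selectable j<n))

  fromExcedanceData-bounded : ∀ i → i < n → p i < n
  fromExcedanceData-bounded i i<n = by-cases (i ∈? X)
    where
    by-cases : Dec (i ∈ X) → p i < n
    by-cases (yes i∈X) = ∈X⇒bounded i∈X
    by-cases (no i∉X)  = ∉X⇒bounded i∉X i<n

  excedance⇒∈X : ∀ {i} → i < n → i < p i → i ∈ X
  excedance⇒∈X {i} i<n i<pi = by-cases (i ∈? X)
    where
    by-cases : Dec (i ∈ X) → i ∈ X
    by-cases (yes i∈X) = i∈X
    by-cases (no i∉X)  = ⊥-elim (<⇒≱ i<pi (∉X⇒nonexcedance i∉X i<n))

  private
    distinct : ∀ {i j} → i < j → j < n → p i ≢ p j
    distinct {i} {j} i<j j<n = by-cases (j ∈? X) (i ∈? X)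
      where
      by-cases : Dec (j ∈ X) → Dec (i ∈ X) → p i ≢ p j
      by-cases (yes j∈X) _         = <⇒≢ (∈X⇒prefix-maximum j∈X i<j)
      by-cases (no j∉X)  (yes i∈X) = λ pi≡pj → ∉X⇒value∉Y j∉X j<n (subst (_∈ Y) pi≡pj (∈X⇒value∈Y i∈X))
      by-cases (no _)    (no i∉X)  = <⇒≢ (∉X⇒suffix-minimum i∉X i<j j<n)

  fromExcedanceData-isPermutation : IsPermutationBelow n p
  fromExcedanceData-isPermutation = record { bounded = fromExcedanceData-bounded ; injective = injective }
    where
    injective : ∀ i j → i < n → j < n → p i ≡ p j → i ≡ j
    injective i j i<n j<n pi≡pj with <-cmp i j
    ... | tri< i<j _ _  = ⊥-elim (distinct i<j j<n pi≡pj)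
    ... | tri≈ _ i≡j _  = i≡j
    ... | tri> _ _ j<i  = ⊥-elim (distinct j<i i<n (sym pi≡pj))

  fromExcedanceData-biIncreasing : BiIncreasingBelow n p
  fromExcedanceData-biIncreasing = π , sumBelow-cong n inversionsAt≡
    where
    π = fromExcedanceData-isPermutation
    inversionsAt≡ : ∀ i → i < n → inversionsAt p n i ≡ p i ∸ i
    inversionsAt≡ i i<n = by-cases (i ∈? X)
      where
      by-cases : Dec (i ∈ X) → inversionsAt p n i ≡ p i ∸ i
      by-cases (yes i∈X) = trans (sym (m+n∸m≡n i _)) (cong (_∸ i) (begin
        i + inversionsAt p n i                          ≡⟨ cong (_+ inversionsAt p n i) all-smaller ⟨
        count i (λ j → p j <? p i) + inversionsAt p n i ≡⟨ smallerBefore+inversionsAt π i i<n ⟩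
        p i                                             ∎))
        where
        open ≡-Reasoning
        all-smaller : count i (λ j → p j <? p i) ≡ i
        all-smaller = count-all (λ j → p j <? p i) i (λ j j<i → ∈X⇒prefix-maximum i∈X j<i)
      by-cases (no i∉X)  = trans
        (count-none (λ j → (i <? j) ×-dec (p j <? p i)) n
                    (λ j j<n (i<j , pj<pi) → <-asym pj<pi (∉X⇒suffix-minimum i∉X i<j j<n)))
        (sym (m≤n⇒m∸n≡0 (∉X⇒nonexcedance i∉X i<n)))

-- Words, and the bijection with excedance data

map-filter : ∀ {A B : Set} {P : A → Set} {Q : B → Set} (P? : ∀ x → Dec (P x)) (Q? : ∀ y → Dec (Q y)) (f : A → B) →
             (∀ x → P x → Q (f x)) → (∀ x → Q (f x) → P x) → ∀ xs → map f (filter P? xs) ≡ filter Q? (map f xs)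
map-filter P? Q? f P⇒Q Q⇒P []       = refl
map-filter P? Q? f P⇒Q Q⇒P (x ∷ xs) with P? x | Q? (f x)
... | yes _  | yes _  = cong (f x ∷_) (map-filter P? Q? f P⇒Q Q⇒P xs)
... | yes px | no ¬qx = ⊥-elim (¬qx (P⇒Q x px))
... | no ¬px | yes qx = ⊥-elim (¬px (Q⇒P x qx))
... | no _   | no _   = map-filter P? Q? f P⇒Q Q⇒P xs

length-filter≡sum : ∀ {A : Set} {P : A → Set} (P? : ∀ x → Dec (P x)) xs →
                    length (filter P? xs) ≡ sum (map (λ x → indicator (P? x)) xs)
length-filter≡sum P? []       = refl
length-filter≡sum P? (x ∷ xs) with P? x
... | yes _ = cong suc (length-filter≡sum P? xs)
... | no _  = length-filter≡sum P? xs

sum-map-filter : ∀ {A : Set} {P : A → Set} (P? : ∀ x → Dec (P x)) (f : A → ℕ) → (∀ x → ¬ P x → f x ≡ 0) →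
                 ∀ xs → sum (map f (filter P? xs)) ≡ sum (map f xs)
sum-map-filter P? f vanish []       = refl
sum-map-filter P? f vanish (x ∷ xs) with P? x
... | yes _  = cong (f x +_) (sum-map-filter P? f vanish xs)
... | no ¬px = trans (sum-map-filter P? f vanish xs) (cong (_+ sum (map f xs)) (sym (vanish x ¬px)))

sum-map-cartesianProduct : ∀ {A B : Set} (g : A × B → ℕ) xs ys →
  sum (map g (cartesianProduct xs ys)) ≡ sum (map (λ x → sum (map (λ y → g (x , y)) ys)) xs)
sum-map-cartesianProduct g []       ys = refl
sum-map-cartesianProduct g (x ∷ xs) ys = begin
  sum (map g (map (x ,_) ys ++ cartesianProduct xs ys))
    ≡⟨ cong sum (map-++ g (map (x ,_) ys) _) ⟩
  sum (map g (map (x ,_) ys) ++ map g (cartesianProduct xs ys))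
    ≡⟨ sum-++ (map g (map (x ,_) ys)) _ ⟩
  sum (map g (map (x ,_) ys)) + sum (map g (cartesianProduct xs ys))
    ≡⟨ cong₂ _+_ (cong sum (sym (map-∘ ys))) (sum-map-cartesianProduct g xs ys) ⟩
  sum (map (λ y → g (x , y)) ys) + sum (map (λ x → sum (map (λ y → g (x , y)) ys)) xs) ∎
  where open ≡-Reasoning

sum-applyUpTo : ∀ (f : ℕ → ℕ) n → sum (applyUpTo f n) ≡ sumBelow n f
sum-applyUpTo f zero    = refl
sum-applyUpTo f (suc n) = cong (f 0 +_) (sum-applyUpTo (f ∘ suc) n)

map-toℕ-allFin : ∀ n → map toℕ (allFin n) ≡ upTo n
map-toℕ-allFin n = trans (map-tabulate id toℕ) (tabulate-toℕ n)
  where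
  tabulate-toℕ : ∀ n → tabulate {n = n} toℕ ≡ upTo n
  tabulate-toℕ zero    = refl
  tabulate-toℕ (suc n) = cong (0 ∷_) (trans (sym (map-tabulate toℕ suc)) (trans (cong (map suc) (tabulate-toℕ n)) (map-upTo suc n)))

sum-map-allFin : ∀ n {f : Fin n → ℕ} (g : ℕ → ℕ) → (∀ i → f i ≡ g (toℕ i)) → sum (map f (allFin n)) ≡ sumBelow n g
sum-map-allFin n {f} g f≡g = begin
  sum (map f (allFin n))           ≡⟨ cong sum (map-cong f≡g (allFin n)) ⟩
  sum (map (g ∘ toℕ) (allFin n))   ≡⟨ cong sum (map-∘ (allFin n)) ⟩
  sum (map g (map toℕ (allFin n))) ≡⟨ cong (sum ∘ map g) (map-toℕ-allFin n) ⟩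
  sum (map g (upTo n))             ≡⟨ cong sum (map-upTo g n) ⟩
  sum (applyUpTo g n)              ≡⟨ sum-applyUpTo g n ⟩
  sumBelow n g                     ∎
  where open ≡-Reasoning

-- positions past the end of the word read as 0
at : ∀ {n m} → Vec (Fin n) m → ℕ → ℕ
at []       _       = 0
at (x ∷ xs) zero    = toℕ x
at (x ∷ xs) (suc i) = at xs i

at-toℕ : ∀ {n m} (v : Vec (Fin n) m) i → at v (toℕ i) ≡ toℕ (lookup v i)
at-toℕ (x ∷ v) zero    = refl
at-toℕ (x ∷ v) (suc i) = at-toℕ v i

at-fromℕ< : ∀ {n m} (v : Vec (Fin n) m) {i} (i<m : i < m) → at v i ≡ toℕ (lookup v (fromℕ< i<m))
at-fromℕ< v {i} i<m = trans (cong (at v) (sym (toℕ-fromℕ< i<m))) (at-toℕ v (fromℕ< i<m))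

at-injective : ∀ {n m} (v w : Vec (Fin n) m) → (∀ i → i < m → at v i ≡ at w i) → v ≡ w
at-injective []      []      _  = refl
at-injective (x ∷ v) (y ∷ w) eq =
  cong₂ _∷_ (toℕ-injective (eq 0 z<s)) (at-injective v w (λ i i<m → eq (suc i) (s<s i<m)))

excedanceList : (ℕ → ℕ) → ℕ → List ℕ
excedanceList p n = filter (λ i → i <? p i) (upTo n)

module _ (p : ℕ → ℕ) (n : ℕ) where

  excedanceList-increasing : Linked _<_ (excedanceList p n)
  excedanceList-increasing = Linked.filter⁺ (λ i → i <? p i) <-trans (Linked.applyUpTo⁺₂ id n n<1+n)

  ∈-excedanceList⁻ : ∀ {x} → x ∈ excedanceList p n → x < n × x < p x
  ∈-excedanceList⁻ x∈ = let x∈upTo , x<px = ∈-filter⁻ (λ i → i <? p i) x∈ in ∈-upTo⁻ x∈upTo , x<px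

  ∈-excedanceList⁺ : ∀ {x} → x < n → x < p x → x ∈ excedanceList p n
  ∈-excedanceList⁺ x<n x<px = ∈-filter⁺ (λ i → i <? p i) (∈-upTo⁺ x<n) x<px

module _ {n : ℕ} (π : Word n) where
  private
    p = at π
    val≡ : ∀ i → val π i ≡ p (toℕ i)
    val≡ i = sym (at-toℕ π i)

  map-toℕ-excedances : map toℕ (excedances π) ≡ excedanceList p n
  map-toℕ-excedances = trans
    (map-filter (λ i → toℕ i <? val π i) (λ i → i <? p i) toℕ
                (λ i → subst (toℕ i <_) (val≡ i)) (λ i → subst (toℕ i <_) (sym (val≡ i))) (allFin n))
    (cong (filter (λ i → i <? p i)) (map-toℕ-allFin n))

  exc≡length : exc π ≡ length (excedanceList p n)
  exc≡length = trans (sym (length-map toℕ (excedances π))) (cong length map-toℕ-excedances)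

  dexc≡sum : dexc π ≡ sum (map (λ i → p i ∸ i) (excedanceList p n))
  dexc≡sum = cong sum (begin
    map (λ i → val π i ∸ toℕ i) (excedances π)   ≡⟨ map-cong (λ i → cong (_∸ toℕ i) (val≡ i)) (excedances π) ⟩
    map ((λ i → p i ∸ i) ∘ toℕ) (excedances π)   ≡⟨ map-∘ (excedances π) ⟩
    map (λ i → p i ∸ i) (map toℕ (excedances π)) ≡⟨ cong (map (λ i → p i ∸ i)) map-toℕ-excedances ⟩
    map (λ i → p i ∸ i) (excedanceList p n)      ∎)
    where open ≡-Reasoning

  dexc≡excedanceDistance : dexc π ≡ excedanceDistance p n
  dexc≡excedanceDistance = begin
    dexc π
      ≡⟨ dexc≡sum ⟩
    sum (map (λ i → p i ∸ i) (excedanceList p n))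
      ≡⟨ sum-map-filter (λ i → i <? p i) _ (λ i i≮pi → m≤n⇒m∸n≡0 (≮⇒≥ i≮pi)) (upTo n) ⟩
    sum (map (λ i → p i ∸ i) (upTo n))
      ≡⟨ cong sum (map-upTo _ n) ⟩
    sum (applyUpTo (λ i → p i ∸ i) n)
      ≡⟨ sum-applyUpTo _ n ⟩
    excedanceDistance p n ∎
    where open ≡-Reasoning

  inv≡inversions : inv π ≡ inversions p n
  inv≡inversions = begin
    inv π
      ≡⟨ length-filter≡sum R? (cartesianProduct (allFin n) (allFin n)) ⟩
    sum (map (indicator ∘ R?) (cartesianProduct (allFin n) (allFin n)))
      ≡⟨ sum-map-cartesianProduct (indicator ∘ R?) (allFin n) (allFin n) ⟩
    sum (map (λ i → sum (map (λ j → indicator (R? (i , j))) (allFin n))) (allFin n))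
      ≡⟨ sum-map-allFin n (inversionsAt p n) row ⟩
    inversions p n ∎
    where
    open ≡-Reasoning
    R? : ∀ (ij : Fin n × Fin n) → Dec (toℕ (proj₁ ij) < toℕ (proj₂ ij) × val π (proj₂ ij) < val π (proj₁ ij))
    R? (i , j) = (toℕ i <? toℕ j) ×-dec (val π j <? val π i)
    row : ∀ i → sum (map (λ j → indicator (R? (i , j))) (allFin n)) ≡ inversionsAt p n (toℕ i)
    row i = sum-map-allFin n _ λ j → indicator-cong
      (λ (i<j , πj<πi) → i<j , subst₂ _<_ (val≡ j) (val≡ i) πj<πi)
      (λ (i<j , pj<pi) → i<j , subst₂ _<_ (sym (val≡ j)) (sym (val≡ i)) pj<pi) _ _

  isPermutation⇒ : IsPermutation π → IsPermutationBelow n p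
  isPermutation⇒ unique = record { bounded = bounded ; injective = injective }
    where
    bounded : ∀ i → i < n → p i < n
    bounded i i<n = subst (_< n) (sym (at-fromℕ< π i<n)) (toℕ<n _)
    injective : ∀ i j → i < n → j < n → p i ≡ p j → i ≡ j
    injective i j i<n j<n pi≡pj = begin
      i                ≡⟨ toℕ-fromℕ< i<n ⟨
      toℕ (fromℕ< i<n) ≡⟨ cong toℕ (lookup-injective unique _ _ (toℕ-injective lookups≡)) ⟩
      toℕ (fromℕ< j<n) ≡⟨ toℕ-fromℕ< j<n ⟩
      j                ∎
      where
      open ≡-Reasoning
      lookups≡ : toℕ (lookup π (fromℕ< i<n)) ≡ toℕ (lookup π (fromℕ< j<n))
      lookups≡ = trans (sym (at-fromℕ< π i<n)) (trans pi≡pj (at-fromℕ< π j<n))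

  biIncreasing⇒ : IsPermutation π → BiIncreasing π → BiIncreasingBelow n p
  biIncreasing⇒ unique bi = isPermutation⇒ unique , trans (sym inv≡inversions) (trans bi dexc≡excedanceDistance)

HasExcedanceData : ℕ → ℕ → ℕ → List ℕ × List ℕ → Set
HasExcedanceData n e k (X , Y) = IsExcedanceData n X Y × length X ≡ e × sum (zipWith _∸_ Y X) ≡ k

ExcedanceData : ℕ → ℕ → ℕ → Set
ExcedanceData n e k = [ XY ∈ List ℕ × List ℕ ∣ HasExcedanceData n e k XY ]

map-strictMono : ∀ {A : ℕ → Set} (f : ℕ → ℕ) → (∀ {i j} → A j → i < j → f i < f j) →
                 ∀ {xs} → All A xs → Linked _<_ xs → Linked _<_ (map f xs)
map-strictMono f mono []              []          = []
map-strictMono f mono (_ ∷ [])        [-]         = [-]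
map-strictMono f mono (_ ∷ aj ∷ axs)  (i<j ∷ lnk) = mono aj i<j ∷ map-strictMono f mono (aj ∷ axs) lnk

All⇒Pointwise-map : ∀ {R : ℕ → ℕ → Set} (f : ℕ → ℕ) {xs} → All (λ x → R x (f x)) xs → Pointwise R xs (map f xs)
All⇒Pointwise-map f []         = []
All⇒Pointwise-map f (r ∷ rs)   = r ∷ All⇒Pointwise-map f rs

zipWith-map-self : ∀ (_∙_ : ℕ → ℕ → ℕ) (f : ℕ → ℕ) xs → zipWith _∙_ (map f xs) xs ≡ map (λ x → f x ∙ x) xs
zipWith-map-self _∙_ f []       = refl
zipWith-map-self _∙_ f (x ∷ xs) = cong (f x ∙ x ∷_) (zipWith-map-self _∙_ f xs)

map-≡⇒≡ : ∀ {f g : ℕ → ℕ} {xs x} → map f xs ≡ map g xs → x ∈ xs → f x ≡ g x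
map-≡⇒≡ {xs = y ∷ xs} eq (here refl)  = proj₁ (∷-injective eq)
map-≡⇒≡ {xs = y ∷ xs} eq (there x∈xs) = map-≡⇒≡ (proj₂ (∷-injective eq)) x∈xs

increasing-≡ : ∀ {xs ys} → Linked _<_ xs → Linked _<_ ys →
               (∀ {x} → x ∈ xs → x ∈ ys) → (∀ {y} → y ∈ ys → y ∈ xs) → xs ≡ ys
increasing-≡ {[]}     {[]}     _  _  _  _  = refl
increasing-≡ {[]}     {y ∷ ys} _  _  _  ys⊆ with () ← ys⊆ (here refl)
increasing-≡ {x ∷ xs} {[]}     _  _  xs⊆ _ with () ← xs⊆ (here refl)
increasing-≡ {x ∷ xs} {y ∷ ys} lx ly xs⊆ ys⊆ = cong₂ _∷_ x≡y (increasing-≡ (tail lx) (tail ly) xs⊆′ ys⊆′)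
  where
  x≡y : x ≡ y
  x≡y with xs⊆ (here refl) | ys⊆ (here refl)
  ... | here x≡y   | _          = x≡y
  ... | there _    | here y≡x   = sym y≡x
  ... | there x∈ys | there y∈xs = ⊥-elim (<-asym (All.lookup (head<tail ly) x∈ys) (All.lookup (head<tail lx) y∈xs))
  xs⊆′ : ∀ {z} → z ∈ xs → z ∈ ys
  xs⊆′ z∈xs with xs⊆ (there z∈xs)
  ... | here z≡y   = ⊥-elim (<⇒≢ (All.lookup (head<tail lx) z∈xs) (sym (trans z≡y (sym x≡y))))
  ... | there z∈ys = z∈ys
  ys⊆′ : ∀ {z} → z ∈ ys → z ∈ xs
  ys⊆′ z∈ys with ys⊆ (there z∈ys)
  ... | here z≡x   = ⊥-elim (<⇒≢ (All.lookup (head<tail ly) z∈ys) (sym (trans z≡x x≡y)))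
  ... | there z∈xs = z∈xs

excedanceData : (ℕ → ℕ) → ℕ → List ℕ × List ℕ
excedanceData p n = excedanceList p n , map p (excedanceList p n)

module _ {n : ℕ} {p : ℕ → ℕ} (bp : BiIncreasingBelow n p) where
  private
    X = excedanceList p n
    open IsPermutationBelow (proj₁ bp)
    membership : All (λ x → x < n × x < p x) X
    membership = All.tabulate (∈-excedanceList⁻ p n)

  excedanceData-valid : IsExcedanceData n X (map p X)
  excedanceData-valid = record
    { X-increasing = excedanceList-increasing p n
    ; Y-increasing = map-strictMono p (λ (j<n , j<pj) i<j → excedance⇒prefix-maximum (proj₁ bp) (proj₂ bp) j<n j<pj i<j)
                                    membership (excedanceList-increasing p n)
    ; X<Y          = All⇒Pointwise-map p (All.map proj₂ membership)
    ; Y<n          = All.map⁺ (All.map (λ (x<n , _) → bounded _ x<n) membership)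
    }

excedanceData-injective : ∀ {n p s} → BiIncreasingBelow n p → BiIncreasingBelow n s →
                          excedanceData p n ≡ excedanceData s n → ∀ i → i < n → p i ≡ s i
excedanceData-injective {n} {p} {s} bp bs eq = biIncreasing-unique bp bs at-p at-s
  where
  X≡ : excedanceList p n ≡ excedanceList s n
  X≡ = ,-injectiveˡ eq
  Y≡ : map p (excedanceList p n) ≡ map s (excedanceList s n)
  Y≡ = ,-injectiveʳ eq
  at-p : ∀ i → i < n → i < p i → p i ≡ s i
  at-p i i<n i<pi = map-≡⇒≡ (trans Y≡ (cong (map s) (sym X≡))) (∈-excedanceList⁺ p n i<n i<pi)
  at-s : ∀ i → i < n → i < s i → p i ≡ s i
  at-s i i<n i<si = map-≡⇒≡ (trans (cong (map p) (sym X≡)) Y≡) (∈-excedanceList⁺ s n i<n i<si)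

module _ {n X Y} (D : IsExcedanceData n X Y) where
  open IsExcedanceData D
  private
    q = fromExcedanceData n X Y
    X<n : ∀ {x} → x ∈ X → x < n
    X<n x∈X = <-trans (∈X⇒excedance D x∈X) (∈X⇒bounded D x∈X)

  excedanceData-fromExcedanceData : ∀ {p} → (∀ i → i < n → p i ≡ q i) → excedanceData p n ≡ (X , Y)
  excedanceData-fromExcedanceData {p} p≗q = cong₂ _,_ X≡ (trans (cong (map p) X≡) Y≡)
    where
    X≡ : excedanceList p n ≡ X
    X≡ = increasing-≡ (excedanceList-increasing p n) X-increasing
      (λ x∈ → let x<n , x<px = ∈-excedanceList⁻ p n x∈ in excedance⇒∈X D x<n (subst (_ <_) (p≗q _ x<n) x<px))
      (λ x∈X → ∈-excedanceList⁺ p n (X<n x∈X) (subst (_ <_) (sym (p≗q _ (X<n x∈X))) (∈X⇒excedance D x∈X)))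
    Y≡ : map p X ≡ Y
    Y≡ = trans (map-cong-local (All.tabulate λ x∈X → trans (p≗q _ (X<n x∈X)) (fromExcedanceData-∈ D x∈X)))
               (map-nth-rank X-increasing (Pointwise-length X<Y))

-- D is irrelevant so that word applies to the erased proofs inside a refinement type.
word : ∀ n X Y → .(IsExcedanceData n X Y) → Word n
word n X Y D = Vec.tabulate (λ i → fromℕ< (fromExcedanceData-bounded D (toℕ i) (toℕ<n i)))

module _ {n X Y} .(D : IsExcedanceData n X Y) where

  at-word : ∀ i → i < n → at (word n X Y D) i ≡ fromExcedanceData n X Y i
  at-word i i<n = begin
    at (word n X Y D) i                                               ≡⟨ at-fromℕ< (word n X Y D) i<n ⟩
    toℕ (lookup (word n X Y D) (fromℕ< i<n))                          ≡⟨ cong toℕ (Vec.lookup∘tabulate _ (fromℕ< i<n)) ⟩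
    toℕ (fromℕ< (fromExcedanceData-bounded D _ (toℕ<n (fromℕ< i<n)))) ≡⟨ toℕ-fromℕ< _ ⟩
    fromExcedanceData n X Y (toℕ (fromℕ< i<n))                        ≡⟨ cong (fromExcedanceData n X Y) (toℕ-fromℕ< i<n) ⟩
    fromExcedanceData n X Y i                                         ∎
    where open ≡-Reasoning

module _ {n X Y} (D : IsExcedanceData n X Y) where
  private
    w = word n X Y D
    q = fromExcedanceData n X Y
    open IsPermutationBelow (fromExcedanceData-isPermutation D)

  word-isPermutation : IsPermutation w
  word-isPermutation = tabulate⁺ λ {i} {j} eq → toℕ-injective (injective (toℕ i) (toℕ j) (toℕ<n i) (toℕ<n j)
    (trans (sym (toℕ-fromℕ< _)) (trans (cong toℕ eq) (toℕ-fromℕ< _))))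

  word-biIncreasing : BiIncreasing w
  word-biIncreasing = begin
    inv w                      ≡⟨ inv≡inversions w ⟩
    inversions (at w) n        ≡⟨ inversions-cong (at-word D) ⟩
    inversions q n             ≡⟨ proj₂ (fromExcedanceData-biIncreasing D) ⟩
    excedanceDistance q n      ≡⟨ excedanceDistance-cong (at-word D) ⟨
    excedanceDistance (at w) n ≡⟨ dexc≡excedanceDistance w ⟨
    dexc w                     ∎
    where open ≡-Reasoning

  excedanceData-word : excedanceData (at w) n ≡ (X , Y)
  excedanceData-word = excedanceData-fromExcedanceData D (at-word D)

  exc-word : exc w ≡ length X
  exc-word = trans (exc≡length w) (cong (λ d → length (proj₁ d)) excedanceData-word)

  dexc-word : dexc w ≡ sum (zipWith _∸_ Y X)
  dexc-word = begin
    dexc w                               ≡⟨ dexc≡sum w ⟩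
    sum (map (λ i → at w i ∸ i) Xw)      ≡⟨ cong sum (zipWith-map-self _∸_ (at w) Xw) ⟨
    sum (zipWith _∸_ (map (at w) Xw) Xw) ≡⟨ cong (λ d → sum (zipWith _∸_ (proj₂ d) (proj₁ d))) excedanceData-word ⟩
    sum (zipWith _∸_ Y X)                ∎
    where
    open ≡-Reasoning
    Xw = excedanceList (at w) n

IsBiIncPerm : ∀ {n} → ℕ → ℕ → Word n → Set
IsBiIncPerm e k π = IsPermutation π × BiIncreasing π × exc π ≡ e × dexc π ≡ k

module _ {n e k : ℕ} where

  excedanceData-has : (π : Word n) → IsBiIncPerm e k π →
                      HasExcedanceData n e k (excedanceData (at π) n)
  excedanceData-has π (unique , bi , exc≡e , dexc≡k) =
    excedanceData-valid (biIncreasing⇒ π unique bi) ,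
    trans (sym (exc≡length π)) exc≡e ,
    trans (cong sum (zipWith-map-self _∸_ (at π) (excedanceList (at π) n))) (trans (sym (dexc≡sum π)) dexc≡k)

  word-has : ∀ {X Y} ((D , _) : HasExcedanceData n e k (X , Y)) → IsBiIncPerm e k (word n X Y D)
  word-has (D , len , dist) = word-isPermutation D , word-biIncreasing D , trans (exc-word D) len , trans (dexc-word D) dist

  word-excedanceData : (π : Word n) ((unique , bi , _) : IsBiIncPerm e k π) →
                       word n _ _ (excedanceData-valid (biIncreasing⇒ π unique bi)) ≡ π
  word-excedanceData π (unique , bi , _) = at-injective w π
    (excedanceData-injective (biIncreasing⇒ w (word-isPermutation D) (word-biIncreasing D)) bπ (excedanceData-word D))
    where
    bπ = biIncreasing⇒ π unique bi
    D = excedanceData-valid bπ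
    w = word n _ _ D

biIncPerms↔excedanceData : ∀ n e k → BiIncPerms n e k ↔ ExcedanceData n e k
biIncPerms↔excedanceData n e k = mk↔ₛ′ to from to∘from from∘to
  where
  to : BiIncPerms n e k → ExcedanceData n e k
  to (π , [ h ]) = excedanceData (at π) n , [ excedanceData-has π h ]

  from : ExcedanceData n e k → BiIncPerms n e k
  from ((X , Y) , [ h ]) = word n X Y (proj₁ h) , [ word-has h ]

  to∘from : ∀ d → to (from d) ≡ d
  to∘from ((X , Y) , [ h ]) =
    value-injective (recompute (Product.≡-dec (List.≡-dec _≟_) (List.≡-dec _≟_) _ _) (excedanceData-word (proj₁ h)))

  from∘to : ∀ π → from (to π) ≡ π
  from∘to (π , [ h ]) = value-injective (recompute (Vec.≡-dec Fin._≟_ _ _) (word-excedanceData π h))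

-- Lattice paths given by the heights of their east steps

climb : ℕ → Path → Path
climb zero    p = p
climb (suc k) p = N ∷ climb k p

-- east steps at the heights hs, starting from height y and closed off at height T
path : ℕ → List ℕ → ℕ → Path
path y []       T = climb (T ∸ y) []
path y (h ∷ hs) T = climb (h ∸ y) (E ∷ path h hs T)

Ascending : ℕ → List ℕ → ℕ → Set
Ascending y []       T = y ≤ T
Ascending y (h ∷ hs) T = y ≤ h × Ascending h hs T

Ascending-≤ : ∀ {y hs T} → Ascending y hs T → y ≤ T
Ascending-≤ {hs = []}     y≤T          = y≤T
Ascending-≤ {hs = h ∷ hs} (y≤h , asc) = ≤-trans y≤h (Ascending-≤ asc)

Ascending-lower : ∀ {y′ y hs T} → y′ ≤ y → Ascending y hs T → Ascending y′ hs T
Ascending-lower {hs = []}     y′≤y y≤T          = ≤-trans y′≤y y≤T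
Ascending-lower {hs = h ∷ hs} y′≤y (y≤h , asc) = ≤-trans y′≤y y≤h , asc

Ascending⇒All≤ : ∀ {y hs T} → Ascending y hs T → All (_≤ T) hs
Ascending⇒All≤ {hs = []}     _           = []
Ascending⇒All≤ {hs = h ∷ hs} (_ , asc) = Ascending-≤ asc ∷ Ascending⇒All≤ asc

xEnd-climb : ∀ k p → xEnd (climb k p) ≡ xEnd p
xEnd-climb zero    p = refl
xEnd-climb (suc k) p = xEnd-climb k p

yEnd-climb : ∀ k p → yEnd (climb k p) ≡ k + yEnd p
yEnd-climb zero    p = refl
yEnd-climb (suc k) p = cong suc (yEnd-climb k p)

eastHeightsFrom-climb : ∀ k y p → eastHeightsFrom y (climb k p) ≡ eastHeightsFrom (k + y) p
eastHeightsFrom-climb zero    y p = refl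
eastHeightsFrom-climb (suc k) y p = trans (eastHeightsFrom-climb k (suc y) p) (cong (λ z → eastHeightsFrom z p) (+-suc k y))

y+[h∸y+w]≡h+w : ∀ {y h} w → y ≤ h → y + ((h ∸ y) + w) ≡ h + w
y+[h∸y+w]≡h+w {y} {h} w y≤h = trans (sym (+-assoc y (h ∸ y) w)) (cong (_+ w) (m+[n∸m]≡n y≤h))

xEnd-path : ∀ y hs T → xEnd (path y hs T) ≡ length hs
xEnd-path y []       T = xEnd-climb (T ∸ y) []
xEnd-path y (h ∷ hs) T = trans (xEnd-climb (h ∸ y) _) (cong suc (xEnd-path h hs T))

yEnd-path : ∀ {y hs T} → Ascending y hs T → y + yEnd (path y hs T) ≡ T
yEnd-path {y} {[]}     {T} y≤T = trans (cong (y +_) (trans (yEnd-climb (T ∸ y) []) (+-identityʳ _))) (m+[n∸m]≡n y≤T)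
yEnd-path {y} {h ∷ hs} {T} (y≤h , asc) =
  trans (cong (y +_) (yEnd-climb (h ∸ y) _)) (trans (y+[h∸y+w]≡h+w _ y≤h) (yEnd-path asc))

eastHeightsFrom-path : ∀ {y hs T} → Ascending y hs T → eastHeightsFrom y (path y hs T) ≡ hs
eastHeightsFrom-path {y} {[]}     {T} _           = eastHeightsFrom-climb (T ∸ y) y []
eastHeightsFrom-path {y} {h ∷ hs} {T} (y≤h , asc) =
  trans (eastHeightsFrom-climb (h ∸ y) y _)
        (trans (cong (λ z → eastHeightsFrom z (E ∷ path h hs T)) (m∸n+n≡m y≤h))
               (cong (h ∷_) (eastHeightsFrom-path asc)))

eastHeightsFrom-≥ : ∀ y p → All (y ≤_) (eastHeightsFrom y p)
eastHeightsFrom-≥ y []      = []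
eastHeightsFrom-≥ y (N ∷ p) = All.map (≤-trans (n≤1+n y)) (eastHeightsFrom-≥ (suc y) p)
eastHeightsFrom-≥ y (E ∷ p) = ≤-refl ∷ eastHeightsFrom-≥ y p

Ascending-eastHeightsFrom : ∀ y p → Ascending y (eastHeightsFrom y p) (y + yEnd p)
Ascending-eastHeightsFrom y []      = m≤m+n y 0
Ascending-eastHeightsFrom y (N ∷ p) = subst (Ascending y (eastHeightsFrom (suc y) p)) (sym (+-suc y (yEnd p)))
  (Ascending-lower (n≤1+n y) (Ascending-eastHeightsFrom (suc y) p))
Ascending-eastHeightsFrom y (E ∷ p) = ≤-refl , Ascending-eastHeightsFrom y p

path-eastHeightsFrom : ∀ y p → path y (eastHeightsFrom y p) (y + yEnd p) ≡ p
path-eastHeightsFrom y []      = cong (λ k → climb k []) (trans (cong (_∸ y) (+-identityʳ y)) (n∸n≡0 y))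
path-eastHeightsFrom y (E ∷ p) = trans (cong (λ k → climb k (E ∷ path y (eastHeightsFrom y p) (y + yEnd p))) (n∸n≡0 y))
                                       (cong (E ∷_) (path-eastHeightsFrom y p))
path-eastHeightsFrom y (N ∷ p) = begin
  path y hs (y + suc (yEnd p))         ≡⟨ cong (path y hs) (+-suc y (yEnd p)) ⟩
  path y hs (suc y + yEnd p)           ≡⟨ path-start-north (eastHeightsFrom-≥ (suc y) p) (s≤s (m≤m+n y (yEnd p))) ⟩
  N ∷ path (suc y) hs (suc y + yEnd p) ≡⟨ cong (N ∷_) (path-eastHeightsFrom (suc y) p) ⟩
  N ∷ p                                ∎
  where
  open ≡-Reasoning
  hs = eastHeightsFrom (suc y) p
  path-start-north : ∀ {y hs T} → All (suc y ≤_) hs → suc y ≤ T → path y hs T ≡ N ∷ path (suc y) hs T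
  path-start-north {y} {[]}     {T} []        y<T = cong (λ k → climb k []) (+-∸-assoc 1 y<T)
  path-start-north {y} {h ∷ hs} {T} (y<h ∷ _) _   = cong (λ k → climb k (E ∷ path h hs T)) (+-∸-assoc 1 y<h)

take-climb-≤ : ∀ {t k} r → t ≤ k → take t (climb k r) ≡ climb t []
take-climb-≤ {zero}          r _         = refl
take-climb-≤ {suc t} {suc k} r (s≤s t≤k) = cong (N ∷_) (take-climb-≤ r t≤k)

take-climb-+ : ∀ k s r → take (k + s) (climb k r) ≡ climb k (take s r)
take-climb-+ zero    s r = refl
take-climb-+ (suc k) s r = cong (N ∷_) (take-climb-+ k s r)

point-climb-≤ : ∀ {t k} r → t ≤ k → xEnd (take t (climb k r)) ≡ 0 × yEnd (take t (climb k r)) ≡ t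
point-climb-≤ {t} r t≤k rewrite take-climb-≤ r t≤k = xEnd-climb t [] , trans (yEnd-climb t []) (+-identityʳ t)

point-climb-E : ∀ k s r → xEnd (take (k + suc s) (climb k (E ∷ r))) ≡ suc (xEnd (take s r))
                        × yEnd (take (k + suc s) (climb k (E ∷ r))) ≡ k + yEnd (take s r)
point-climb-E k s r rewrite take-climb-+ k (suc s) (E ∷ r) = xEnd-climb k _ , yEnd-climb k _

OnPath : ℕ → List ℕ → ℕ → ℕ → ℕ → Set
OnPath y []       T x       z = x ≡ 0 × y ≤ z × z ≤ T
OnPath y (h ∷ hs) T zero    z = y ≤ z × z ≤ h
OnPath y (h ∷ hs) T (suc x) z = OnPath h hs T x z

OnPath-≥ : ∀ {y hs T x z} → Ascending y hs T → OnPath y hs T x z → y ≤ z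
OnPath-≥ {hs = []}                 _           (_ , y≤z , _) = y≤z
OnPath-≥ {hs = h ∷ hs} {x = zero}  _           (y≤z , _)     = y≤z
OnPath-≥ {hs = h ∷ hs} {x = suc x} (y≤h , asc) on            = ≤-trans y≤h (OnPath-≥ asc on)

data ClimbSplit (k : ℕ) : ℕ → Set where
  during : ∀ {t} → t ≤ k → ClimbSplit k t
  after  : ∀ s → ClimbSplit k (k + suc s)

climbSplit : ∀ k t → ClimbSplit k t
climbSplit k t with t ≤? k
... | yes t≤k = during t≤k
... | no t≰k  = subst (ClimbSplit k) (trans (+-suc k _) (m+[n∸m]≡n (≰⇒> t≰k))) (after (t ∸ suc k))

point-OnPath : ∀ {y hs T} → Ascending y hs T → ∀ t →
               OnPath y hs T (xEnd (take t (path y hs T))) (y + yEnd (take t (path y hs T)))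
point-OnPath {y} {[]} {T} y≤T t with climbSplit (T ∸ y) t
... | during t≤k = let x≡0 , z≡t = point-climb-≤ [] t≤k in
  x≡0 , m≤m+n y _ , subst (λ z → y + z ≤ T) (sym z≡t) (subst (y + t ≤_) (m+[n∸m]≡n y≤T) (+-monoʳ-≤ y t≤k))
... | after s rewrite take-climb-+ (T ∸ y) (suc s) [] =
  xEnd-climb (T ∸ y) [] , m≤m+n y _ , ≤-reflexive (yEnd-path y≤T)
point-OnPath {y} {h ∷ hs} {T} (y≤h , asc) t with climbSplit (h ∸ y) t
... | during t≤k = let x≡0 , z≡t = point-climb-≤ (E ∷ path h hs T) t≤k in
  subst₂ (OnPath y (h ∷ hs) T) (sym x≡0) (cong (y +_) (sym z≡t))
         (m≤m+n y t , subst (y + t ≤_) (m+[n∸m]≡n y≤h) (+-monoʳ-≤ y t≤k))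
... | after s = let x≡ , z≡ = point-climb-E (h ∸ y) s (path h hs T) in
  subst₂ (OnPath y (h ∷ hs) T) (sym x≡) (trans (sym (y+[h∸y+w]≡h+w _ y≤h)) (cong (y +_) (sym z≡))) (point-OnPath asc s)

OnPath⇒point : ∀ {y hs T x z} → Ascending y hs T → OnPath y hs T x z →
               xEnd (take (x + (z ∸ y)) (path y hs T)) ≡ x × y + yEnd (take (x + (z ∸ y)) (path y hs T)) ≡ z
OnPath⇒point {y} {[]} {T} {z = z} _ (refl , y≤z , z≤T) =
  let x≡0 , t≡ = point-climb-≤ [] (∸-monoˡ-≤ y z≤T) in x≡0 , trans (cong (y +_) t≡) (m+[n∸m]≡n y≤z)
OnPath⇒point {y} {h ∷ hs} {T} {zero} {z} _ (y≤z , z≤h) =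
  let x≡0 , t≡ = point-climb-≤ (E ∷ path h hs T) (∸-monoˡ-≤ y z≤h) in x≡0 , trans (cong (y +_) t≡) (m+[n∸m]≡n y≤z)
OnPath⇒point {y} {h ∷ hs} {T} {suc x} {z} (y≤h , asc) on =
  subst (λ t → xEnd (take t P) ≡ suc x × y + yEnd (take t P) ≡ z) (sym time≡)
    (trans x≡ (cong suc (proj₁ IH)) , trans (cong (y +_) z≡) (trans (y+[h∸y+w]≡h+w _ y≤h) (proj₂ IH)))
  where
  P = path y (h ∷ hs) T
  x≡ = proj₁ (point-climb-E (h ∸ y) (x + (z ∸ h)) (path h hs T))
  z≡ = proj₂ (point-climb-E (h ∸ y) (x + (z ∸ h)) (path h hs T))
  IH = OnPath⇒point asc on
  time≡ : suc x + (z ∸ y) ≡ (h ∸ y) + suc (x + (z ∸ h))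
  time≡ = begin
    suc x + (z ∸ y)               ≡⟨ cong (λ w → suc x + (w ∸ y)) (m+[n∸m]≡n (OnPath-≥ asc on)) ⟨
    suc x + (h + (z ∸ h) ∸ y)     ≡⟨ cong (suc x +_) (+-∸-comm (z ∸ h) y≤h) ⟩
    suc (x + ((h ∸ y) + (z ∸ h))) ≡⟨ cong suc (x∙yz≈y∙xz x (h ∸ y) (z ∸ h)) ⟩
    suc ((h ∸ y) + (x + (z ∸ h))) ≡⟨ +-suc (h ∸ y) _ ⟨
    (h ∸ y) + suc (x + (z ∸ h))   ∎
    where open ≡-Reasoning

length≡xEnd+yEnd : ∀ p → length p ≡ xEnd p + yEnd p
length≡xEnd+yEnd []      = refl
length≡xEnd+yEnd (N ∷ p) = trans (cong suc (length≡xEnd+yEnd p)) (sym (+-suc (xEnd p) (yEnd p)))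
length≡xEnd+yEnd (E ∷ p) = cong suc (length≡xEnd+yEnd p)

xEnd+yEnd-take : ∀ t p → t ≤ length p → xEnd (take t p) + yEnd (take t p) ≡ t
xEnd+yEnd-take zero    p       _         = refl
xEnd+yEnd-take (suc t) (N ∷ p) (s≤s t≤l) = trans (+-suc _ _) (cong suc (xEnd+yEnd-take t p t≤l))
xEnd+yEnd-take (suc t) (E ∷ p) (s≤s t≤l) = cong suc (xEnd+yEnd-take t p t≤l)

Ascending-intro : ∀ {y hs T} → Linked _<_ hs → All (y ≤_) hs → All (_≤ T) hs → y ≤ T → Ascending y hs T
Ascending-intro {hs = []}     _   _         _            y≤T = y≤T
Ascending-intro {hs = h ∷ hs} lnk (y≤h ∷ _) (h≤T ∷ hs≤T) _   =
  y≤h , Ascending-intro (tail lnk) (All.map <⇒≤ (head<tail lnk)) hs≤T h≤T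

upperHeights : ℕ → List ℕ → List ℕ
upperHeights n Y = map suc Y ∷ʳ suc n

lowerHeights : List ℕ → List ℕ
lowerHeights X = 0 ∷ map suc X

-- In every column but the first and last, the lower path's vertical segment ends strictly
-- below the point where the upper one starts, since x < y for consecutive entries.
common-point⇒end : ∀ {T X Y x₀ y β x z} → x₀ < y → Pointwise _<_ X Y →
                   OnPath (suc y) (map suc Y ∷ʳ T) T x z → OnPath β (suc x₀ ∷ map suc X) T x z →
                   x ≡ suc (length X) × z ≡ T
common-point⇒end {Y = []}    {x = zero} x₀<y _ (y<z , _) (_ , z≤x₀) = ⊥-elim (<⇒≱ (s≤s x₀<y) (≤-trans y<z z≤x₀))
common-point⇒end {Y = _ ∷ _} {x = zero} x₀<y _ (y<z , _) (_ , z≤x₀) = ⊥-elim (<⇒≱ (s≤s x₀<y) (≤-trans y<z z≤x₀))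
common-point⇒end {X = []} {[]} {x = suc zero} _ [] (_ , T≤z , z≤T) (refl , _ , _) = refl , ≤-antisym z≤T T≤z
common-point⇒end {X = []} {[]} {x = suc (suc x)} _ [] (() , _) _
common-point⇒end {X = _ ∷ _} {_ ∷ _} {x = suc x} _ (x₁<y₁ ∷ X<Y) onU onL =
  let x≡ , z≡ = common-point⇒end x₁<y₁ X<Y onU onL in cong suc x≡ , z≡

common-point⇒start-or-end : ∀ {n X Y x z} → Pointwise _<_ X Y →
                            OnPath 0 (upperHeights n Y) (suc n) x z → OnPath 0 (lowerHeights X) (suc n) x z →
                            (x ≡ 0 × z ≡ 0) ⊎ (x ≡ suc (length X) × z ≡ suc n)
common-point⇒start-or-end {x = zero} _ _ (_ , z≤0) = inj₁ (refl , n≤0⇒n≡0 z≤0)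
common-point⇒start-or-end {X = []} {[]} {x = suc zero} [] (_ , T≤z , z≤T) (refl , _ , _) = inj₂ (refl , ≤-antisym z≤T T≤z)
common-point⇒start-or-end {X = []} {[]} {x = suc (suc x)} [] (() , _) _
common-point⇒start-or-end {X = _ ∷ _} {_ ∷ _} {x = suc x} (x₀<y₀ ∷ X<Y) onU onL =
  let x≡ , z≡ = common-point⇒end x₀<y₀ X<Y onU onL in inj₂ (cong suc x≡ , z≡)

upperPath : ℕ → List ℕ → Path
upperPath n Y = path 0 (upperHeights n Y) (suc n)

lowerPath : ℕ → List ℕ → Path
lowerPath n X = path 0 (lowerHeights X) (suc n)

upperHeights-increasing : ∀ {n Y} → Linked _<_ Y → All (_< n) Y → Linked _<_ (upperHeights n Y)
upperHeights-increasing {Y = []}         _           _              = [-]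
upperHeights-increasing {Y = _ ∷ []}     _           (y<n ∷ [])     = s≤s y<n ∷ [-]
upperHeights-increasing {Y = _ ∷ _ ∷ _}  (y<y′ ∷ lnk) (_ ∷ Y<n)      = s≤s y<y′ ∷ upperHeights-increasing lnk Y<n

map-suc-increasing : ∀ {X} → Linked _<_ X → Linked _<_ (map suc X)
map-suc-increasing []          = []
map-suc-increasing [-]         = [-]
map-suc-increasing (x<x′ ∷ lnk) = s≤s x<x′ ∷ map-suc-increasing lnk

lowerHeights-increasing : ∀ {X} → Linked _<_ X → Linked _<_ (lowerHeights X)
lowerHeights-increasing {[]}    _   = [-]
lowerHeights-increasing {_ ∷ _} lnk = z<s ∷ map-suc-increasing lnk

module _ {n X Y} (D : IsExcedanceData n X Y) where
  open IsExcedanceData D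

  X-bounded : All (_< n) X
  X-bounded = pointwise-< X<Y Y<n
    where
    pointwise-< : ∀ {X Y} → Pointwise _<_ X Y → All (_< n) Y → All (_< n) X
    pointwise-< []           []         = []
    pointwise-< (x<y ∷ X<Y) (y<n ∷ Y<n) = <-trans x<y y<n ∷ pointwise-< X<Y Y<n

  upperHeights-ascending : Ascending 0 (upperHeights n Y) (suc n)
  upperHeights-ascending = Ascending-intro (upperHeights-increasing Y-increasing Y<n) (All.universal (λ _ → z≤n) _)
    (All.++⁺ (All.map⁺ (All.map <⇒≤ (All.map s≤s Y<n))) (≤-refl ∷ [])) z≤n

  lowerHeights-ascending : Ascending 0 (lowerHeights X) (suc n)
  lowerHeights-ascending = Ascending-intro (lowerHeights-increasing X-increasing) (All.universal (λ _ → z≤n) _)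
    (z≤n ∷ All.map⁺ (All.map <⇒≤ (All.map s≤s X-bounded))) z≤n

  xEnd-upperPath : xEnd (upperPath n Y) ≡ suc (length Y)
  xEnd-upperPath = trans (xEnd-path 0 (upperHeights n Y) (suc n))
    (trans (length-++ (map suc Y)) (trans (+-comm _ 1) (cong suc (length-map suc Y))))

  xEnd-lowerPath : xEnd (lowerPath n X) ≡ suc (length X)
  xEnd-lowerPath = trans (xEnd-path 0 (lowerHeights X) (suc n)) (cong suc (length-map suc X))

  yEnd-upperPath : yEnd (upperPath n Y) ≡ suc n
  yEnd-upperPath = yEnd-path upperHeights-ascending

  yEnd-lowerPath : yEnd (lowerPath n X) ≡ suc n
  yEnd-lowerPath = yEnd-path lowerHeights-ascending

  paths-meet-only-at-ends : ∀ t → 0 < t → t < length (upperPath n Y) → point (upperPath n Y) t ≢ point (lowerPath n X) t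
  paths-meet-only-at-ends t 0<t t<len same-point with common-point⇒start-or-end X<Y onU onL
    where
    U = upperPath n Y
    x = xEnd (take t U)
    z = yEnd (take t U)
    onU : OnPath 0 (upperHeights n Y) (suc n) x z
    onU = point-OnPath upperHeights-ascending t
    onL : OnPath 0 (lowerHeights X) (suc n) x z
    onL = subst₂ (OnPath 0 (lowerHeights X) (suc n)) (sym (,-injectiveˡ same-point)) (sym (,-injectiveʳ same-point))
                 (point-OnPath lowerHeights-ascending t)
  ... | inj₁ (x≡0 , z≡0) = <⇒≢ 0<t (trans (sym (cong₂ _+_ x≡0 z≡0)) (xEnd+yEnd-take t _ (<⇒≤ t<len)))
  ... | inj₂ (x≡ , z≡)   = <⇒≢ t<len (begin
    t                                   ≡⟨ xEnd+yEnd-take t _ (<⇒≤ t<len) ⟨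
    xEnd (take t U′) + yEnd (take t U′) ≡⟨ cong₂ _+_ x≡ z≡ ⟩
    suc (length X) + suc n              ≡⟨ cong (λ l → suc l + suc n) (Pointwise-length X<Y) ⟩
    suc (length Y) + suc n              ≡⟨ cong₂ _+_ xEnd-upperPath yEnd-upperPath ⟨
    xEnd U′ + yEnd U′                   ≡⟨ length≡xEnd+yEnd U′ ⟨
    length U′                           ∎)
    where
    open ≡-Reasoning
    U′ = upperPath n Y

area-telescope : ∀ {n c X Y} → Pointwise _<_ X Y → Ascending c (upperHeights n Y) (suc n) →
                 sum (zipWith _∸_ (upperHeights n Y) (c ∷ map suc X)) + c ≡ sum (zipWith _∸_ Y X) + suc n
area-telescope {n} {c} []  (c≤n+1 , _) = trans (cong (_+ c) (+-identityʳ (suc n ∸ c))) (m∸n+n≡m c≤n+1)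
area-telescope {n} {c} {x ∷ X} {y ∷ Y} (x<y ∷ X<Y) (c≤y+1 , asc) = begin
  (suc y ∸ c) + F + c                       ≡⟨ +-assoc (suc y ∸ c) F c ⟩
  (suc y ∸ c) + (F + c)                     ≡⟨ cong ((suc y ∸ c) +_) (+-comm F c) ⟩
  (suc y ∸ c) + (c + F)                     ≡⟨ +-assoc (suc y ∸ c) c F ⟨
  (suc y ∸ c) + c + F                       ≡⟨ cong (_+ F) (m∸n+n≡m c≤y+1) ⟩
  suc y + F                                 ≡⟨ cong (λ w → suc w + F) (m∸n+n≡m (<⇒≤ x<y)) ⟨
  suc ((y ∸ x) + x) + F                     ≡⟨ cong (_+ F) (+-suc (y ∸ x) x) ⟨
  (y ∸ x) + suc x + F                       ≡⟨ +-assoc (y ∸ x) (suc x) F ⟩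
  (y ∸ x) + (suc x + F)                     ≡⟨ cong ((y ∸ x) +_) (+-comm (suc x) F) ⟩
  (y ∸ x) + (F + suc x)                     ≡⟨ cong ((y ∸ x) +_) (area-telescope X<Y (Ascending-lower (s≤s (<⇒≤ x<y)) asc)) ⟩
  (y ∸ x) + (sum (zipWith _∸_ Y X) + suc n) ≡⟨ +-assoc (y ∸ x) _ (suc n) ⟨
  (y ∸ x) + sum (zipWith _∸_ Y X) + suc n   ∎
  where
  open ≡-Reasoning
  F = sum (zipWith _∸_ (upperHeights n Y) (suc x ∷ map suc X))

N∷-NoDoubleEast : ∀ {p} → NoDoubleEast p → NoDoubleEast (N ∷ p)
N∷-NoDoubleEast {[]}    _   = [-]
N∷-NoDoubleEast {_ ∷ _} nde = (λ { (() , _) }) ∷ nde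

NoDoubleEast-climb : ∀ k {r} → NoDoubleEast r → NoDoubleEast (climb k r)
NoDoubleEast-climb zero    nde = nde
NoDoubleEast-climb (suc k) nde = N∷-NoDoubleEast (NoDoubleEast-climb k nde)

E∷-NoDoubleEast : ∀ k {r} → NoDoubleEast (climb k r) → k ≢ 0 ⊎ r ≡ [] → NoDoubleEast (E ∷ climb k r)
E∷-NoDoubleEast zero    _   (inj₁ k≢0)  = ⊥-elim (k≢0 refl)
E∷-NoDoubleEast zero    _   (inj₂ refl) = [-]
E∷-NoDoubleEast (suc k) nde _           = (λ { (_ , ()) }) ∷ nde

NoDoubleEast-path : ∀ {y hs T} → Linked _<_ hs → NoDoubleEast (path y hs T)
NoDoubleEast-path {y} {[]}          {T} _ = NoDoubleEast-climb (T ∸ y) []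
NoDoubleEast-path {y} {h ∷ []}      {T} _ =
  NoDoubleEast-climb (h ∸ y) (E∷-NoDoubleEast (T ∸ h) (NoDoubleEast-climb (T ∸ h) []) (inj₂ refl))
NoDoubleEast-path {y} {h ∷ h′ ∷ hs} {T} (h<h′ ∷ lnk) =
  NoDoubleEast-climb (h ∸ y) (E∷-NoDoubleEast (h′ ∸ h) (NoDoubleEast-path {h} lnk) (inj₁ (m>n⇒m∸n≢0 h<h′)))

NoDoubleEast⇒eastHeights-increasing : ∀ y p → NoDoubleEast p → Linked _<_ (eastHeightsFrom y p)
NoDoubleEast⇒eastHeights-increasing y []          _          = []
NoDoubleEast⇒eastHeights-increasing y (N ∷ p)     nde        = NoDoubleEast⇒eastHeights-increasing (suc y) p (tail nde)
NoDoubleEast⇒eastHeights-increasing y (E ∷ [])    _          = [-]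
NoDoubleEast⇒eastHeights-increasing y (E ∷ E ∷ p) (¬EE ∷ _)  = ⊥-elim (¬EE (refl , refl))
NoDoubleEast⇒eastHeights-increasing y (E ∷ N ∷ p) (_ ∷ nde)  =
  ∷-increasing (eastHeightsFrom-≥ (suc y) p) (NoDoubleEast⇒eastHeights-increasing (suc y) p (tail nde))
  where
  ∷-increasing : ∀ {xs} → All (suc y ≤_) xs → Linked _<_ xs → Linked _<_ (y ∷ xs)
  ∷-increasing {[]}    _          _   = [-]
  ∷-increasing {_ ∷ _} (y<x ∷ _) lnk = y<x ∷ lnk

dropLast : List ℕ → List ℕ
dropLast []           = []
dropLast (x ∷ [])     = []
dropLast (x ∷ y ∷ ys) = x ∷ dropLast (y ∷ ys)

dropLast-∷ʳ : ∀ xs x → dropLast (xs ∷ʳ x) ≡ xs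
dropLast-∷ʳ []           x = refl
dropLast-∷ʳ (y ∷ [])     x = refl
dropLast-∷ʳ (y ∷ z ∷ xs) x = cong (y ∷_) (dropLast-∷ʳ (z ∷ xs) x)

-- Walking both paths column by column: a lower height reaching the upper path's current
-- height would give a common point, and so would an upper path ending below T.
meet-only-at-end⇒separated :
  ∀ {T α β as bs} → length as ≡ length bs → β ≤ α → α ≤ T → Linked _<_ (α ∷ as) → All (_≤ T) as →
  (∀ {x z} → OnPath α as T x z → OnPath β bs T x z → length as + T ≤ x + z) →
  α ∷ as ≡ dropLast (α ∷ as) ∷ʳ T × Pointwise _<_ bs (dropLast (α ∷ as))
meet-only-at-end⇒separated {T} {α} {β} {[]} {[]} _ β≤α α≤T _ _ meet with m≤n⇒m<n∨m≡n α≤T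
... | inj₂ refl = refl , []
... | inj₁ (s≤s α≤T′) =
  ⊥-elim (1+n≰n (meet {0} (refl , α≤T′ , n≤1+n _) (refl , ≤-trans β≤α α≤T′ , n≤1+n _)))
meet-only-at-end⇒separated {T} {α} {β} {a ∷ as} {b ∷ bs} len β≤α α≤T (α<a ∷ lnk) (a≤T ∷ as≤T) meet with b <? α
... | no b≮α  = ⊥-elim (<⇒≱ (s≤s (≤-trans α≤T (m≤n+m T (length as))))
                            (meet {0} {α} (≤-refl , <⇒≤ α<a) (β≤α , ≮⇒≥ b≮α)))
... | yes b<α =
  let ends , bs<as = meet-only-at-end⇒separated (suc-injective len) (<⇒≤ (<-trans b<α α<a)) a≤T lnk as≤T
                       (λ {x} {z} onU onL → s≤s⁻¹ (meet {suc x} {z} onU onL))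
  in cong (α ∷_) ends , b<α ∷ bs<as

separated-heights : ∀ {T a bs} → length a ≡ suc (length bs) → Ascending 0 a T → Linked _<_ a →
                    (∀ {x z} → OnPath 0 a T (suc x) z → OnPath 0 (0 ∷ bs) T (suc x) z → length a + T ≤ suc x + z) →
                    a ≡ dropLast a ∷ʳ T × Pointwise _<_ bs (dropLast a)
separated-heights {a = α ∷ as} len (_ , asc) lnk meet =
  meet-only-at-end⇒separated (suc-injective len) z≤n (Ascending-≤ asc) lnk (Ascending⇒All≤ asc)
                             (λ {x} {z} onU onL → s≤s⁻¹ (meet {x} {z} onU onL))

∷ʳ-increasing⁻ : ∀ {xs x} → Linked _<_ (xs ∷ʳ x) → Linked _<_ xs × All (_< x) xs
∷ʳ-increasing⁻ {[]}         _              = [] , []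
∷ʳ-increasing⁻ {y ∷ []}     (y<x ∷ _)      = [-] , y<x ∷ []
∷ʳ-increasing⁻ {y ∷ z ∷ xs} (y<z ∷ lnk) with ∷ʳ-increasing⁻ {z ∷ xs} lnk
... | lnk′ , z<x ∷ xs<x = y<z ∷ lnk′ , <-trans y<z z<x ∷ z<x ∷ xs<x

map-suc-increasing⁻ : ∀ {X} → Linked _<_ (map suc X) → Linked _<_ X
map-suc-increasing⁻ {[]}         _              = []
map-suc-increasing⁻ {_ ∷ []}     _              = [-]
map-suc-increasing⁻ {_ ∷ _ ∷ _}  (s≤s x<x′ ∷ lnk) = x<x′ ∷ map-suc-increasing⁻ lnk

map-suc-pred : ∀ {xs} → All (0 <_) xs → map suc (map pred xs) ≡ xs
map-suc-pred []              = refl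
map-suc-pred (s≤s z≤n ∷ pos) = cong (_ ∷_) (map-suc-pred pos)

map-pred-suc : ∀ xs → map pred (map suc xs) ≡ xs
map-pred-suc xs = trans (sym (map-∘ xs)) (List.map-id xs)

All-dropLast : ∀ {P : ℕ → Set} {xs} → All P xs → All P (dropLast xs)
All-dropLast {xs = []}         []            = []
All-dropLast {xs = _ ∷ []}     _             = []
All-dropLast {xs = _ ∷ _ ∷ _}  (px ∷ pxs)    = px ∷ All-dropLast pxs

-- Step polyominoes and excedance data

decode : Path × Path → List ℕ × List ℕ
decode (u , l) = map pred (drop 1 (eastHeights l)) , map pred (dropLast (eastHeights u))

encode : ℕ → List ℕ × List ℕ → Path × Path
encode n (X , Y) = upperPath n Y , lowerPath n X

length-eastHeightsFrom : ∀ y p → length (eastHeightsFrom y p) ≡ xEnd p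
length-eastHeightsFrom y []      = refl
length-eastHeightsFrom y (N ∷ p) = length-eastHeightsFrom (suc y) p
length-eastHeightsFrom y (E ∷ p) = cong suc (length-eastHeightsFrom y p)

decode-correct : ∀ {n u l} → IsStepPolyomino (u , l) → height (u , l) ≡ suc n →
                 IsExcedanceData n (proj₁ (decode (u , l))) (proj₂ (decode (u , l))) × encode n (decode (u , l)) ≡ (u , l)
decode-correct {n} {N ∷ u′} {E ∷ l′} ((xEnd≡ , yEnd≡ , first , first , meet) , nde-u , nde-l) height≡ =
  valid , cong₂ _,_ (trans (cong (λ hs → path 0 hs T) upper≡) u≡) (trans (cong (λ hs → path 0 hs T) lower≡) l≡)
  where
  u = N ∷ u′
  l = E ∷ l′
  T = suc n
  a = eastHeights u
  bs = eastHeightsFrom 0 l′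
  X = map pred bs
  Y = map pred (dropLast a)
  asc-u : Ascending 0 a T
  asc-u = subst (Ascending 0 a) height≡ (Ascending-eastHeightsFrom 0 u)
  asc-l : Ascending 0 (0 ∷ bs) T
  asc-l = subst (Ascending 0 (0 ∷ bs)) (trans (sym yEnd≡) height≡) (Ascending-eastHeightsFrom 0 l)
  u≡ : path 0 a T ≡ u
  u≡ = trans (cong (path 0 a) (sym height≡)) (path-eastHeightsFrom 0 u)
  l≡ : path 0 (0 ∷ bs) T ≡ l
  l≡ = trans (cong (path 0 (0 ∷ bs)) (trans (sym height≡) yEnd≡)) (path-eastHeightsFrom 0 l)
  a-increasing : Linked _<_ a
  a-increasing = NoDoubleEast⇒eastHeights-increasing 0 u nde-u
  b-increasing : Linked _<_ (0 ∷ bs)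
  b-increasing = NoDoubleEast⇒eastHeights-increasing 0 l nde-l
  length-u : length u ≡ length a + T
  length-u = trans (length≡xEnd+yEnd u) (cong₂ _+_ (sym (length-eastHeightsFrom 0 u)) height≡)
  point≡ : ∀ {hs p x z} → path 0 hs T ≡ p → Ascending 0 hs T → OnPath 0 hs T x z → point p (x + z) ≡ (x , z)
  point≡ refl asc on = let x≡ , z≡ = OnPath⇒point asc on in cong₂ _,_ x≡ z≡
  meet-at-end : ∀ {x z} → OnPath 0 a T (suc x) z → OnPath 0 (0 ∷ bs) T (suc x) z → length a + T ≤ suc x + z
  meet-at-end {x} {z} onU onL = ≮⇒≥ λ t<len → meet (suc x + z) z<s (subst (suc x + z <_) (sym length-u) t<len)
    (trans (point≡ u≡ asc-u onU) (sym (point≡ l≡ asc-l onL)))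
  separated = separated-heights (trans (length-eastHeightsFrom 0 u) (trans xEnd≡ (cong suc (sym (length-eastHeightsFrom 0 l′)))))
                                asc-u a-increasing meet-at-end
  upper≡ : upperHeights n Y ≡ a
  upper≡ = trans (cong (_∷ʳ T) (map-suc-pred (All-dropLast (eastHeightsFrom-≥ 1 u′)))) (sym (proj₁ separated))
  lower≡ : lowerHeights X ≡ 0 ∷ bs
  lower≡ = cong (0 ∷_) (map-suc-pred (head<tail b-increasing))
  valid : IsExcedanceData n X Y
  valid = record
    { X-increasing = map-suc-increasing⁻ (tail (subst (Linked _<_) (sym lower≡) b-increasing))
    ; Y-increasing = map-suc-increasing⁻ (proj₁ Y-facts)
    ; X<Y          = Pointwise.map s≤s⁻¹ (Pointwise.map⁻ suc suc
                       (subst₂ (Pointwise _<_) (sym (map-suc-pred (head<tail b-increasing)))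
                               (sym (map-suc-pred (All-dropLast (eastHeightsFrom-≥ 1 u′)))) (proj₂ separated)))
    ; Y<n          = All.map s≤s⁻¹ (All.map⁻ (proj₂ Y-facts))
    }
    where
    Y-facts = ∷ʳ-increasing⁻ (subst (Linked _<_) (sym upper≡) a-increasing)

upperPath-starts-north : ∀ n Y → FirstStep N (upperPath n Y)
upperPath-starts-north n []      = first
upperPath-starts-north n (_ ∷ _) = first

module _ {n X Y} (D : IsExcedanceData n X Y) where
  open IsExcedanceData D

  private
    eastHeights-upperPath : eastHeights (upperPath n Y) ≡ upperHeights n Y
    eastHeights-upperPath = eastHeightsFrom-path (upperHeights-ascending D)
    eastHeights-lowerPath : eastHeights (lowerPath n X) ≡ lowerHeights X
    eastHeights-lowerPath = eastHeightsFrom-path (lowerHeights-ascending D)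

  decode-encode : decode (encode n (X , Y)) ≡ (X , Y)
  decode-encode = cong₂ _,_
    (trans (cong (map pred ∘ drop 1) eastHeights-lowerPath) (map-pred-suc X))
    (trans (cong (map pred ∘ dropLast) eastHeights-upperPath)
           (trans (cong (map pred) (dropLast-∷ʳ (map suc Y) (suc n))) (map-pred-suc Y)))

  encode-isStepPolyomino : IsStepPolyomino (encode n (X , Y))
  encode-isStepPolyomino =
    ( trans (xEnd-upperPath D) (trans (cong suc (sym (Pointwise-length X<Y))) (sym (xEnd-lowerPath D)))
    , trans (yEnd-upperPath D) (sym (yEnd-lowerPath D))
    , upperPath-starts-north n Y
    , first
    , paths-meet-only-at-ends D )
    , NoDoubleEast-path {0} {T = suc n} (upperHeights-increasing Y-increasing Y<n)
    , NoDoubleEast-path {0} {T = suc n} (lowerHeights-increasing X-increasing)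

  width-encode : width (encode n (X , Y)) ≡ suc (length X)
  width-encode = trans (xEnd-upperPath D) (cong suc (sym (Pointwise-length X<Y)))

  area-encode : area (encode n (X , Y)) ≡ sum (zipWith _∸_ Y X) + suc n
  area-encode = begin
    area (encode n (X , Y))
      ≡⟨ cong₂ (λ us ls → sum (zipWith _∸_ us ls)) eastHeights-upperPath eastHeights-lowerPath ⟩
    sum (zipWith _∸_ (upperHeights n Y) (lowerHeights X))
      ≡⟨ +-identityʳ _ ⟨
    sum (zipWith _∸_ (upperHeights n Y) (lowerHeights X)) + 0
      ≡⟨ area-telescope X<Y (upperHeights-ascending D) ⟩
    sum (zipWith _∸_ Y X) + suc n ∎
    where open ≡-Reasoning

IsStepPolyOf : ℕ → ℕ → ℕ → Path × Path → Set
IsStepPolyOf w h a P = IsStepPolyomino P × width P ≡ w × height P ≡ h × area P ≡ a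

module _ {n e k : ℕ} where
  private
    k+n+1≡ : k + n + 1 ≡ k + suc n
    k+n+1≡ = trans (+-assoc k n 1) (cong (k +_) (+-comm n 1))

  encode-has : ∀ {X Y} → HasExcedanceData n e k (X , Y) → IsStepPolyOf (suc e) (suc n) (k + n + 1) (encode n (X , Y))
  encode-has (D , len , dist) = encode-isStepPolyomino D , trans (width-encode D) (cong suc len) , yEnd-upperPath D ,
    trans (area-encode D) (trans (cong (_+ suc n) dist) (sym k+n+1≡))

  decode-has : ∀ {P} → IsStepPolyOf (suc e) (suc n) (k + n + 1) P → HasExcedanceData n e k (decode P)
  decode-has (step , width≡ , height≡ , area≡) = D , len , dist
    where
    D = proj₁ (decode-correct step height≡)
    encode≡ = proj₂ (decode-correct step height≡)
    len = suc-injective (trans (sym (width-encode D)) (trans (cong width encode≡) width≡))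
    dist = +-cancelʳ-≡ (suc n) _ _ (trans (sym (area-encode D)) (trans (cong area encode≡) (trans area≡ k+n+1≡)))

  encode-decode : ∀ {P} → IsStepPolyOf (suc e) (suc n) (k + n + 1) P → encode n (decode P) ≡ P
  encode-decode (step , _ , height≡ , _) = proj₂ (decode-correct step height≡)

_≟-Step_ : DecidableEquality Step
N ≟-Step N = yes refl
N ≟-Step E = no λ ()
E ≟-Step N = no λ ()
E ≟-Step E = yes refl

excedanceData↔stepPolys : ∀ n e k → ExcedanceData n e k ↔ StepPolys (suc e) (suc n) (k + n + 1)
excedanceData↔stepPolys n e k = mk↔ₛ′ to from to∘from from∘to
  where
  to : ExcedanceData n e k → StepPolys (suc e) (suc n) (k + n + 1)
  to ((X , Y) , [ h ]) = encode n (X , Y) , [ encode-has h ]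

  from : StepPolys (suc e) (suc n) (k + n + 1) → ExcedanceData n e k
  from (P , [ h ]) = decode P , [ decode-has h ]

  to∘from : ∀ P → to (from P) ≡ P
  to∘from (P , [ h ]) = value-injective (recompute (Product.≡-dec (List.≡-dec _≟-Step_) (List.≡-dec _≟-Step_) _ _)
    (encode-decode h))

  from∘to : ∀ d → from (to d) ≡ d
  from∘to ((X , Y) , [ h ]) = value-injective (recompute (Product.≡-dec (List.≡-dec _≟_) (List.≡-dec _≟_) _ _)
    (decode-encode (proj₁ h)))

theorem3p1 : (n e k : ℕ) → 1 ≤ n →
    BiIncPerms n e k ⤖ StepPolys (suc e) (suc n) (k + n + 1)
theorem3p1 n e k _ = ↔⇒⤖ (excedanceData↔stepPolys n e k ↔-∘ biIncPerms↔excedanceData n e k)
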